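{- Let $G$ be a minimal counterexample, fixed with a plane embedding, as described in the context, and let $v$ be a 5-vertex of $G$. If $m_3(v)=5$, then $n_6(v)=5$ and $m_3(w)\leq 4$ for every 6-vertex $w$ adjacent to $v$.
   Context: All graphs are finite and simple. A 2-distance $k$-coloring of a graph $G$ is a map $\phi: V(G)\to\{1,\dots,k\}$ with $\phi(x)\neq\phi(y)$ whenever $x\neq y$ are at distance at most two; $\chi_2(G)$ is the least such $k$. A minimal counterexample is a planar graph $G$ with maximum degree $\Delta(G)\leq 6$ and $\chi_2(G)>20$ such that every planar graph $H$ with $\Delta(H)\leq 6$ and $|V(H)|+|E(H)|<|V(G)|+|E(G)|$ satisfies $\chi_2(H)\leq 20$. A $k$-vertex is a vertex of degree exactly $k$. The degree of a face is the number of edges in its boundary; a $k$-face is a face of degree $k$. A face is incident with the vertices and edges on its boundary. $m_k(v)$ denotes the number of $k$-faces incident with $v$, and $n_k(v)$ the number of $k$-vertices adjacent to $v$. -}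

module Defs where

open import Data.Nat using (ℕ; zero; suc; _+_; _*_; _≤_; _<_; _≤ᵇ_; _<ᵇ_; _≡ᵇ_)
open import Data.Bool using (Bool; true; false; _∧_; _∨_; not; if_then_else_)
open import Data.Fin using (Fin; toℕ) renaming (zero to fz; suc to fs)
open import Data.Fin.Properties using () renaming (_≟_ to _≟ᶠ_)
open import Data.Product using (Σ; ∃-syntax; _×_; _,_; proj₁; proj₂)
open import Relation.Nullary using (¬_)
open import Relation.Nullary.Decidable using (⌊_⌋)
open import Relation.Binary.PropositionalEquality using (_≡_; _≢_)

count : ∀ {n} → (Fin n → Bool) → ℕ
count {zero}  p = 0
count {suc n} p = (if p fz then 1 else 0) + count (λ i → p (fs i))

sumF : ∀ {n} → (Fin n → ℕ) → ℕ
sumF {zero}  f = 0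
sumF {suc n} f = f fz + sumF (λ i → f (fs i))

anyF : ∀ {n} → (Fin n → Bool) → Bool
anyF {zero}  p = false
anyF {suc n} p = p fz ∨ anyF (λ i → p (fs i))

allF : ∀ {n} → (Fin n → Bool) → Bool
allF {zero}  p = true
allF {suc n} p = p fz ∧ allF (λ i → p (fs i))

count2 : ∀ {n} → (Fin n → Fin n → Bool) → ℕ
count2 p = sumF (λ i → count (p i))

iter : ∀ {A : Set} → (A → A) → ℕ → A → A
iter f zero    x = x
iter f (suc k) x = f (iter f k x)

record Graph : Set where
  field
    n      : ℕ
    adj    : Fin n → Fin n → Bool
    sym    : ∀ u w → adj u w ≡ adj w u
    irrefl : ∀ u → adj u u ≡ false

module _ (G : Graph) where
  open Graph G

  deg : Fin n → ℕ
  deg v = count (adj v)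

  numEdges : ℕ
  numEdges = count2 (λ u w → adj u w ∧ (toℕ u <ᵇ toℕ w))

  size : ℕ
  size = n + numEdges

  MaxDegreeAtMost : ℕ → Set
  MaxDegreeAtMost d = ∀ v → deg v ≤ d

  nbrsOfDeg : ℕ → Fin n → ℕ
  nbrsOfDeg k v = count (λ w → adj v w ∧ (deg w ≡ᵇ k))

  Dist≤2 : Fin n → Fin n → Set
  Dist≤2 x y = x ≢ y × (adj x y ≡ true ⊎' (∃[ z ] (adj x z ≡ true × adj z y ≡ true)))
    where
      open import Data.Sum using () renaming (_⊎_ to _⊎'_)

  TwoDistColoring : ℕ → Set
  TwoDistColoring k = Σ (Fin n → Fin k) λ φ → ∀ x y → Dist≤2 x y → φ x ≢ φ y

  χ₂≤ : ℕ → Set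
  χ₂≤ k = ∃[ j ] (j ≤ k × TwoDistColoring j)

  reach : ℕ → Fin n → Fin n → Bool
  reach zero    u w = ⌊ u ≟ᶠ w ⌋
  reach (suc k) u w = reach k u w ∨ anyF (λ x → reach k u x ∧ adj x w)

  numComponents : ℕ
  numComponents = count (λ v → allF (λ w → not (reach n v w) ∨ (toℕ v ≤ᵇ toℕ w)))

  numIsolated : ℕ
  numIsolated = count (λ v → deg v ≡ᵇ 0)

  -- Embeddings as rotation systems: rot v is the cyclic successor
  -- function on the neighbourhood of v (clockwise order around v).

  record Rotation : Set where
    field
      rot     : Fin n → Fin n → Fin n
      rot-adj : ∀ v u → adj v u ≡ true → adj v (rot v u) ≡ true
      rot-cyc : ∀ v u w → adj v u ≡ true → adj v w ≡ true →
                ∃[ k ] (iter (rot v) k u ≡ w)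

  Dart : Set
  Dart = Fin n × Fin n

  _≟ᵈ_ : Dart → Dart → Bool
  (a , b) ≟ᵈ (c , d) = ⌊ a ≟ᶠ c ⌋ ∧ ⌊ b ≟ᶠ d ⌋

  key : Dart → ℕ
  key (a , b) = toℕ a * n + toℕ b

  module Faces (R : Rotation) where
    open Rotation R

    -- face-tracing permutation on darts
    φ : Dart → Dart
    φ (u , w) = (w , rot w u)

    inFace : Dart → Dart → Bool
    inFace d e = anyF {suc (n * n)} (λ k → iter φ (toℕ k) d ≟ᵈ e)

    faceDeg : Dart → ℕ
    faceDeg d = count2 (λ u w → adj u w ∧ inFace d (u , w))

    -- d is the chosen representative (least key) of its face
    isRep : Dart → Bool
    isRep d = adj (proj₁ d) (proj₂ d)
              ∧ allF (λ u → allF (λ w → not (inFace d (u , w)) ∨ (key d ≤ᵇ key (u , w))))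

    numFaces : ℕ
    numFaces = count2 (λ u w → isRep (u , w))

    facesOfDegAt : ℕ → Fin n → ℕ
    facesOfDegAt k v = count2 (λ u w → isRep (u , w) ∧ (faceDeg (u , w) ≡ᵇ k)
                                       ∧ anyF (λ x → adj v x ∧ inFace (u , w) (v , x)))

    -- plane (genus 0) embedding: V - E + F = 2c - I
    -- (each component with an edge satisfies Euler's formula for the sphere;
    --  isolated vertices contribute no face orbits)
    IsPlane : Set
    IsPlane = n + numFaces + numIsolated ≡ numEdges + 2 * numComponents

  PlaneEmbedding : Set
  PlaneEmbedding = Σ Rotation (λ R → Faces.IsPlane R)

Planar : Graph → Set
Planar G = PlaneEmbedding G

MinimalCounterexample : Graph → Set
MinimalCounterexample G =
  Planar G × MaxDegreeAtMost G 6 × ¬ χ₂≤ G 20 ×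
  (∀ H → Planar H → MaxDegreeAtMost H 6 → size H < size G → χ₂≤ H 20)

-- As deg v = 5 and the five faces at v are triangles, v is the
-- centre of a wheel whose rim U 0, ..., U 4 is a 5-cycle.  Deleting the five
-- spokes merges the five triangles into one pentagon and leaves v isolated, so
-- Euler's relation survives and the smaller plane graph H has a 2-distance
-- 20-colouring.  As any two rim vertices are within distance two along the
-- rim, this colouring is proper on G away from v, and it extends to v unless
-- 20 distinct vertices lie within distance two of v.  Those vertices are
-- covered by the rim and, for each U i, its at most three neighbours other than
-- v, U (i - 1) and U (i + 1); so these 20 slots are pairwise distinct.  This
-- forces deg U i = 6, and it rules out a triangle at U i on its second and
-- fifth neighbour (counted from v): such a triangle would make an outer
-- neighbour of U i adjacent to U (i - 1) or U (i + 1), identifying two slots.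
-- Hence at most four of the six faces at U i are triangles.

module Submission where
open import Defs
open import Data.Nat using (ℕ; zero; suc; _+_; _*_; _∸_; _%_; _/_; _≤_; _<_; _≤ᵇ_; _<ᵇ_; _≡ᵇ_; z≤n; s≤s; NonZero; ≢-nonZero; _≤?_)
  renaming (_≟_ to _≟ℕ_)
open import Data.Nat.Properties
open import Data.Nat.DivMod using (m≡m%n+[m/n]*n; m%n<n)
open import Data.Bool using (Bool; true; false; _∧_; _∨_; not; if_then_else_; T)
import Data.Bool as Bool
open import Data.Bool.Properties using (∧-zeroʳ; ∧-identityʳ)
open import Data.Fin using (Fin; toℕ; fromℕ<; combine; remQuot; splitAt; _↑ˡ_; _↑ʳ_; punchIn; punchOut; inject≤) renaming (zero to fz; suc to fs)
open import Data.Fin.Properties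
  using (toℕ-injective; toℕ-fromℕ<; toℕ<n; pigeonhole; combine-injective; punchIn-punchOut;
         inject≤-injective; any?; ¬∀⟶∃¬; toℕ-combine; splitAt-↑ˡ; splitAt-↑ʳ; remQuot-combine)
  renaming (_≟_ to _≟ᶠ_)
import Data.Fin.Properties as FinP
open import Data.Product using (Σ; ∃; ∃-syntax; _×_; _,_; proj₁; proj₂)
open import Data.Product.Properties using (≡-dec)
open import Data.Sum using (_⊎_; inj₁; inj₂; [_,_]′; map₂)
open import Data.Empty using (⊥; ⊥-elim)
open import Relation.Nullary using (¬_; yes; no; Dec; _×-dec_)
open import Relation.Nullary.Decidable using (⌊_⌋)
open import Relation.Binary.PropositionalEquality
open import Relation.Binary.Definitions using (tri<; tri≈; tri>; DecidableEquality)
open import Data.Nat.Tactic.RingSolver using (solve-∀)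
open import Algebra.Properties.CommutativeSemigroup +-commutativeSemigroup using (interchange)

∧-elim : ∀ {a b} → a ∧ b ≡ true → a ≡ true × b ≡ true
∧-elim {true} {true} _ = refl , refl

∧-intro : ∀ {a b} → a ≡ true → b ≡ true → a ∧ b ≡ true
∧-intro refl refl = refl

∨-elim : ∀ {a b} → a ∨ b ≡ true → a ≡ true ⊎ b ≡ true
∨-elim {true} _ = inj₁ refl
∨-elim {false} {true} _ = inj₂ refl

∨-introˡ : ∀ {a b} → a ≡ true → a ∨ b ≡ true
∨-introˡ refl = refl

∨-introʳ : ∀ {a b} → b ≡ true → a ∨ b ≡ true
∨-introʳ {true} refl = refl
∨-introʳ {false} refl = refl

true⇒¬false : ∀ {a} → a ≡ true → ¬ a ≡ false
true⇒¬false refl ()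

not-true⇒false : ∀ {a} → not a ≡ true → a ≡ false
not-true⇒false {false} _ = refl

false⇒not-true : ∀ {a} → a ≡ false → not a ≡ true
false⇒not-true refl = refl

¬true⇒false : ∀ {a} → ¬ a ≡ true → a ≡ false
¬true⇒false {false} _ = refl
¬true⇒false {true} h = ⊥-elim (h refl)

∧₃-elim : ∀ {a b c} → (a ∧ b ∧ c) ≡ true → a ≡ true × b ≡ true × c ≡ true
∧₃-elim {true} {true} {true} _ = refl , refl , refl

∨₃-elim : ∀ {a b c} → (a ∨ b ∨ c) ≡ true → a ≡ true ⊎ b ≡ true ⊎ c ≡ true
∨₃-elim {true} _ = inj₁ refl
∨₃-elim {false} {true} _ = inj₂ (inj₁ refl)
∨₃-elim {false} {false} {true} _ = inj₂ (inj₂ refl)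

∨₃-false : ∀ {a b c} → (a ∨ b ∨ c) ≡ false → a ≡ false × b ≡ false × c ≡ false
∨₃-false {false} {false} {false} _ = refl , refl , refl

T⇒≡true : ∀ {a} → T a → a ≡ true
T⇒≡true {true} _ = refl

≡true⇒T : ∀ {a} → a ≡ true → T a
≡true⇒T refl = _

true-ext : ∀ {a b} → (a ≡ true → b ≡ true) → (b ≡ true → a ≡ true) → a ≡ b
true-ext {true} f g = sym (f refl)
true-ext {false} {true} f g = g refl
true-ext {false} {false} f g = refl

_==_ : ∀ {n} → Fin n → Fin n → Bool
a == b = ⌊ a ≟ᶠ b ⌋

==⇒≡ : ∀ {n} {a b : Fin n} → a == b ≡ true → a ≡ b
==⇒≡ {a = a} {b} h with a ≟ᶠ b
... | yes p = p

==-refl : ∀ {n} (a : Fin n) → a == a ≡ true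
==-refl a with a ≟ᶠ a
... | yes _ = refl
... | no q = ⊥-elim (q refl)

≢⇒==false : ∀ {n} {a b : Fin n} → ¬ a ≡ b → a == b ≡ false
≢⇒==false {a = a} {b} q with a ≟ᶠ b
... | yes p = ⊥-elim (q p)
... | no _ = refl

==false⇒≢ : ∀ {n} {a b : Fin n} → a == b ≡ false → ¬ a ≡ b
==false⇒≢ {a = a} h refl = true⇒¬false (==-refl a) h

anyF⇒∃ : ∀ {n} (p : Fin n → Bool) → anyF p ≡ true → ∃[ i ] p i ≡ true
anyF⇒∃ {suc n} p h with p fz in e
... | true = fz , e
... | false = let (i , q) = anyF⇒∃ (λ i → p (fs i)) h in fs i , q

∃⇒anyF : ∀ {n} (p : Fin n → Bool) i → p i ≡ true → anyF p ≡ true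
∃⇒anyF p fz h rewrite h = refl
∃⇒anyF p (fs i) h = ∨-introʳ (∃⇒anyF (λ i → p (fs i)) i h)

allF⇒∀ : ∀ {n} (p : Fin n → Bool) → allF p ≡ true → ∀ i → p i ≡ true
allF⇒∀ p h fz = proj₁ (∧-elim h)
allF⇒∀ p h (fs i) = allF⇒∀ (λ i → p (fs i)) (proj₂ (∧-elim h)) i

∀⇒allF : ∀ {n} (p : Fin n → Bool) → (∀ i → p i ≡ true) → allF p ≡ true
∀⇒allF {zero} p h = refl
∀⇒allF {suc n} p h = ∧-intro (h fz) (∀⇒allF (λ i → p (fs i)) (λ i → h (fs i)))

allF-false⇒∃ : ∀ {n} (p : Fin n → Bool) → allF p ≡ false → ∃[ i ] p i ≡ false
allF-false⇒∃ {suc n} p h with p fz in e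
... | false = fz , e
... | true = let (i , q) = allF-false⇒∃ (λ i → p (fs i)) h in fs i , q

record Counting (A : Set) : Set₁ where
  field
    _≈ᵇ_        : A → A → Bool
    ≈ᵇ⇒≡        : ∀ {x y} → x ≈ᵇ y ≡ true → x ≡ y
    ≈ᵇ-refl     : ∀ x → x ≈ᵇ x ≡ true
    card        : (A → Bool) → ℕ
    card-cong   : ∀ (p q : A → Bool) → (∀ x → p x ≡ q x) → card p ≡ card q
    card-split  : ∀ (p q : A → Bool) → card p ≡ card (λ x → p x ∧ q x) + card (λ x → p x ∧ not (q x))
    card-single : ∀ a → card (λ x → x ≈ᵇ a) ≡ 1
    card-none   : ∀ (p : A → Bool) → (∀ x → p x ≡ false) → card p ≡ 0
    card-witness : ∀ (p : A → Bool) → ¬ card p ≡ 0 → ∃[ x ] p x ≡ true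

module CountingProperties {A : Set} (C : Counting A) where
  open Counting C

  ≢⇒≈ᵇfalse : ∀ {x y} → ¬ x ≡ y → x ≈ᵇ y ≡ false
  ≢⇒≈ᵇfalse {x} {y} ne with x ≈ᵇ y in e
  ... | true = ⊥-elim (ne (≈ᵇ⇒≡ e))
  ... | false = refl

  ∧-absorb : ∀ (p q : A → Bool) → (∀ x → p x ≡ true → q x ≡ true) → ∀ x → p x ≡ (q x ∧ p x)
  ∧-absorb p q h x with p x in e
  ... | true rewrite h x e = refl
  ... | false = sym (∧-zeroʳ (q x))

  card-mono : ∀ (p q : A → Bool) → (∀ x → p x ≡ true → q x ≡ true) → card p ≤ card q
  card-mono p q h = begin
      card p                                                 ≡⟨ card-cong p _ (∧-absorb p q h) ⟩
      card (λ x → q x ∧ p x)                                 ≤⟨ m≤m+n _ _ ⟩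
      card (λ x → q x ∧ p x) + card (λ x → q x ∧ not (p x))  ≡⟨ sym (card-split q p) ⟩
      card q                                                 ∎
    where open ≤-Reasoning

  _∖_ : (A → Bool) → A → A → Bool
  (p ∖ a) x = p x ∧ not (x ≈ᵇ a)

  card-∖ : ∀ (p : A → Bool) a → p a ≡ true → card p ≡ suc (card (p ∖ a))
  card-∖ p a pa = begin
      card p                                     ≡⟨ card-split p (_≈ᵇ a) ⟩
      card (λ x → p x ∧ x ≈ᵇ a) + card (p ∖ a)   ≡⟨ cong (_+ card (p ∖ a)) (trans (card-cong _ _ only-a) (card-single a)) ⟩
      suc (card (p ∖ a))                         ∎
    where
      open ≡-Reasoning
      only-a : ∀ x → (p x ∧ x ≈ᵇ a) ≡ x ≈ᵇ a
      only-a x with x ≈ᵇ a in e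
      ... | true = cong (_∧ true) (subst (λ y → p y ≡ true) (sym (≈ᵇ⇒≡ e)) pa)
      ... | false = ∧-zeroʳ (p x)

  card-∖-absent : ∀ (p : A → Bool) a → p a ≡ false → card (p ∖ a) ≡ card p
  card-∖-absent p a pa = card-cong _ _ keep
    where
      keep : ∀ x → (p x ∧ not (x ≈ᵇ a)) ≡ p x
      keep x with x ≈ᵇ a in e
      ... | true = trans (∧-zeroʳ (p x)) (sym (subst (λ y → p y ≡ false) (sym (≈ᵇ⇒≡ e)) pa))
      ... | false = ∧-identityʳ (p x)

  injection⇒≤card : ∀ k (f : Fin k → A) → (∀ i j → f i ≡ f j → i ≡ j) →
                    ∀ (p : A → Bool) → (∀ i → p (f i) ≡ true) → k ≤ card p
  injection⇒≤card zero f inj p h = z≤n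
  injection⇒≤card (suc k) f inj p h = begin
      suc k               ≤⟨ s≤s (injection⇒≤card k (λ i → f (fs i)) (λ i j e → FinP.suc-injective (inj _ _ e)) (p ∖ f fz) rest) ⟩
      suc (card (p ∖ f fz)) ≡⟨ sym (card-∖ p (f fz) (h fz)) ⟩
      card p              ∎
    where
      open ≤-Reasoning
      rest : ∀ i → (p (f (fs i)) ∧ not (f (fs i) ≈ᵇ f fz)) ≡ true
      rest i = ∧-intro (h (fs i)) (false⇒not-true (≢⇒≈ᵇfalse λ e → FinP.0≢1+n (sym (inj _ _ e))))

  covered⇒card≤ : ∀ k (f : Fin k → A) (p : A → Bool) → (∀ x → p x ≡ true → ∃[ i ] x ≡ f i) → card p ≤ k
  covered⇒card≤ zero f p h = ≤-reflexive (card-none p λ x → ¬true⇒false λ px → case proj₁ (h x px) of λ ())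
    where open import Function using (case_of_)
  covered⇒card≤ (suc k) f p h = begin
      card p                                          ≡⟨ card-split p (_≈ᵇ f fz) ⟩
      card (λ x → p x ∧ x ≈ᵇ f fz) + card (p ∖ f fz)  ≤⟨ +-mono-≤ at-most-one rest ⟩
      suc k                                           ∎
    where
      open ≤-Reasoning
      at-most-one : card (λ x → p x ∧ x ≈ᵇ f fz) ≤ 1
      at-most-one = ≤-trans (card-mono _ _ (λ x e → proj₂ (∧-elim {p x} e))) (≤-reflexive (card-single (f fz)))
      rest : card (p ∖ f fz) ≤ k
      rest = covered⇒card≤ k (λ i → f (fs i)) (p ∖ f fz) cover
        where
          cover : ∀ x → (p x ∧ not (x ≈ᵇ f fz)) ≡ true → ∃[ i ] x ≡ f (fs i)
          cover x e with ∧-elim {p x} e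
          ... | px , x≉f0 with h x px
          ... | fz , refl = ⊥-elim (true⇒¬false (≈ᵇ-refl x) (not-true⇒false x≉f0))
          ... | fs i , x≡fi = i , x≡fi

  card-< : ∀ (p q : A → Bool) a → (∀ x → p x ≡ true → q x ≡ true) → p a ≡ false → q a ≡ true → card p < card q
  card-< p q a h pa qa = ≤-trans (s≤s (card-mono p (q ∖ a) p⊆q∖a)) (≤-reflexive (sym (card-∖ q a qa)))
    where
      p⊆q∖a : ∀ x → p x ≡ true → (q x ∧ not (x ≈ᵇ a)) ≡ true
      p⊆q∖a x px = ∧-intro (h x px) (false⇒not-true (≢⇒≈ᵇfalse λ x≡a → true⇒¬false (subst (λ y → p y ≡ true) x≡a px) pa))

  card-insert : ∀ (p q : A → Bool) a → p a ≡ false → q a ≡ true → (∀ x → ¬ x ≡ a → p x ≡ q x) →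
                card q ≡ suc (card p)
  card-insert p q a pa qa h = begin
      card q              ≡⟨ card-∖ q a qa ⟩
      suc (card (q ∖ a))  ≡⟨ cong suc (card-cong _ _ agree) ⟩
      suc (card (p ∖ a))  ≡⟨ cong suc (card-∖-absent p a pa) ⟩
      suc (card p)        ∎
    where
      open ≡-Reasoning
      agree : ∀ x → (q x ∧ not (x ≈ᵇ a)) ≡ (p x ∧ not (x ≈ᵇ a))
      agree x with x ≈ᵇ a in e
      ... | true = trans (∧-zeroʳ (q x)) (sym (∧-zeroʳ (p x)))
      ... | false = cong (_∧ true) (sym (h x λ x≡a → true⇒¬false (subst (λ y → y ≈ᵇ a ≡ true) (sym x≡a) (≈ᵇ-refl a)) e))

  ⊆-card-≡⇒⊇ : ∀ (p q : A → Bool) → (∀ x → p x ≡ true → q x ≡ true) → card p ≡ card q →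
               ∀ x → q x ≡ true → p x ≡ true
  ⊆-card-≡⇒⊇ p q h eq x qx with p x in e
  ... | true = refl
  ... | false = ⊥-elim (<-irrefl eq (card-< p q x h e qx))

module _ {A B : Set} (CA : Counting A) (CB : Counting B) where
  private
    module A = Counting CA
    module B = Counting CB
    module PA = CountingProperties CA
    module PB = CountingProperties CB

  injection⇒card≤card : ∀ (P : A → Bool) (Q : B → Bool) (g : A → B) →
                        (∀ x → P x ≡ true → Q (g x) ≡ true) →
                        (∀ x y → P x ≡ true → P y ≡ true → g x ≡ g y → x ≡ y) → A.card P ≤ B.card Q
  injection⇒card≤card P Q g PQ inj = go (B.card Q) P Q refl PQ inj
    where
      go : ∀ N (P : A → Bool) (Q : B → Bool) → B.card Q ≡ N → (∀ x → P x ≡ true → Q (g x) ≡ true) →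
           (∀ x y → P x ≡ true → P y ≡ true → g x ≡ g y → x ≡ y) → A.card P ≤ N
      go zero P Q e PQ inj = ≤-reflexive (A.card-none P λ x → ¬true⇒false λ px →
        <-irrefl (sym e) (PB.injection⇒≤card 1 (λ _ → g x) (λ { fz fz _ → refl }) Q (λ _ → PQ x px)))
      go (suc N) P Q e PQ inj with B.card-witness Q (λ e0 → 0≢1+n (trans (sym e0) e))
      ... | b , Qb = begin
          A.card P                                          ≡⟨ A.card-split P (λ x → g x B.≈ᵇ b) ⟩
          A.card (λ x → P x ∧ g x B.≈ᵇ b) + A.card P∖b      ≤⟨ +-mono-≤ fibre≤1 (go N P∖b (Q PB.∖ b) card-Q∖b PQ∖b inj∖b) ⟩
          suc N                                             ∎
        where
          open ≤-Reasoning
          P∖b : A → Bool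
          P∖b x = P x ∧ not (g x B.≈ᵇ b)
          card-Q∖b : B.card (Q PB.∖ b) ≡ N
          card-Q∖b = suc-injective (trans (sym (PB.card-∖ Q b Qb)) e)
          PQ∖b : ∀ x → P∖b x ≡ true → (Q PB.∖ b) (g x) ≡ true
          PQ∖b x t = let (px , nb) = ∧-elim {P x} t in ∧-intro (PQ x px) nb
          inj∖b : ∀ x y → P∖b x ≡ true → P∖b y ≡ true → g x ≡ g y → x ≡ y
          inj∖b x y tx ty = inj x y (proj₁ (∧-elim {P x} tx)) (proj₁ (∧-elim {P y} ty))
          fibre≤1 : A.card (λ x → P x ∧ g x B.≈ᵇ b) ≤ 1
          fibre≤1 with A.card (λ x → P x ∧ g x B.≈ᵇ b) ≟ℕ 0
          ... | yes z = ≤-trans (≤-reflexive z) z≤n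
          ... | no nz with A.card-witness _ nz
          ... | x₀ , t₀ = PA.covered⇒card≤ 1 (λ _ → x₀) _ λ x t →
                let (px , gx≈b) = ∧-elim {P x} t ; (px₀ , gx₀≈b) = ∧-elim {P x₀} t₀
                in fz , inj x x₀ px px₀ (trans (B.≈ᵇ⇒≡ gx≈b) (sym (B.≈ᵇ⇒≡ gx₀≈b)))

count-cong : ∀ {n} (p q : Fin n → Bool) → (∀ x → p x ≡ q x) → count p ≡ count q
count-cong {zero} p q h = refl
count-cong {suc n} p q h = cong₂ _+_ (cong (λ b → if b then 1 else 0) (h fz)) (count-cong _ _ (λ x → h (fs x)))

count-split : ∀ {n} (p q : Fin n → Bool) → count p ≡ count (λ x → p x ∧ q x) + count (λ x → p x ∧ not (q x))
count-split {zero} p q = refl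
count-split {suc n} p q =
  trans (cong₂ _+_ (indicator-split (p fz) (q fz)) (count-split (λ x → p (fs x)) (λ x → q (fs x))))
        (interchange (if p fz ∧ q fz then 1 else 0) _ _ _)
  where
    indicator-split : ∀ a b → (if a then 1 else 0) ≡ (if a ∧ b then 1 else 0) + (if a ∧ not b then 1 else 0)
    indicator-split true true = refl
    indicator-split true false = refl
    indicator-split false b = refl

count-none : ∀ {n} (p : Fin n → Bool) → (∀ x → p x ≡ false) → count p ≡ 0
count-none {zero} p h = refl
count-none {suc n} p h rewrite h fz = count-none (λ x → p (fs x)) (λ x → h (fs x))

count-single : ∀ {n} (a : Fin n) → count (λ x → x == a) ≡ 1
count-single {suc n} fz = cong suc (count-none {n} (λ x → fs x == fz) (λ x → ≢⇒==false {a = fs x} {fz} λ ()))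
count-single {suc n} (fs a) =
  trans (cong (λ b → (if b then 1 else 0) + count (λ x → fs x == fs a)) (≢⇒==false {a = fz} {fs a} λ ()))
        (trans (count-cong _ _ fs==fs) (count-single a))
  where
    fs==fs : ∀ x → (fs x == fs a) ≡ (x == a)
    fs==fs x with x == a in e
    ... | true rewrite ==⇒≡ e = ==-refl (fs a)
    ... | false = ≢⇒==false (λ q → ==false⇒≢ e (FinP.suc-injective q))

count-witness : ∀ {n} (p : Fin n → Bool) → ¬ count p ≡ 0 → ∃[ x ] p x ≡ true
count-witness {zero} p h = ⊥-elim (h refl)
count-witness {suc n} p h with p fz in e
... | true = fz , e
... | false = let (x , px) = count-witness (λ x → p (fs x)) h in fs x , px

count-≤ : ∀ {n} (p : Fin n → Bool) → count p ≤ n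
count-≤ {zero} p = z≤n
count-≤ {suc n} p with p fz
... | true = s≤s (count-≤ (λ x → p (fs x)))
... | false = m≤n⇒m≤1+n (count-≤ (λ x → p (fs x)))

finCounting : ∀ n → Counting (Fin n)
finCounting n = record
  { _≈ᵇ_ = _==_ ; ≈ᵇ⇒≡ = ==⇒≡ ; ≈ᵇ-refl = ==-refl ; card = count
  ; card-cong = count-cong ; card-split = count-split ; card-single = count-single
  ; card-none = count-none ; card-witness = count-witness }

Pair : ℕ → Set
Pair n = Fin n × Fin n

_==ᵖ_ : ∀ {n} → Pair n → Pair n → Bool
(a , b) ==ᵖ (c , d) = (a == c) ∧ (b == d)

==ᵖ⇒≡ : ∀ {n} {x y : Pair n} → x ==ᵖ y ≡ true → x ≡ y
==ᵖ⇒≡ {x = a , b} {c , d} h with ∧-elim {a == c} h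
... | e₁ , e₂ = cong₂ _,_ (==⇒≡ e₁) (==⇒≡ e₂)

==ᵖ-refl : ∀ {n} (x : Pair n) → x ==ᵖ x ≡ true
==ᵖ-refl (a , b) = ∧-intro (==-refl a) (==-refl b)

countᵖ : ∀ {n} → (Pair n → Bool) → ℕ
countᵖ P = count2 (λ a b → P (a , b))

sumF-cong : ∀ {n} (f g : Fin n → ℕ) → (∀ x → f x ≡ g x) → sumF f ≡ sumF g
sumF-cong {zero} f g h = refl
sumF-cong {suc n} f g h = cong₂ _+_ (h fz) (sumF-cong _ _ (λ x → h (fs x)))

sumF-+ : ∀ {n} (f g : Fin n → ℕ) → sumF (λ x → f x + g x) ≡ sumF f + sumF g
sumF-+ {zero} f g = refl
sumF-+ {suc n} f g = trans (cong (f fz + g fz +_) (sumF-+ (λ x → f (fs x)) (λ x → g (fs x)))) (interchange (f fz) _ _ _)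

sumF-none : ∀ {n} (f : Fin n → ℕ) → (∀ x → f x ≡ 0) → sumF f ≡ 0
sumF-none {zero} f h = refl
sumF-none {suc n} f h rewrite h fz = sumF-none _ (λ x → h (fs x))

sumF-indicator : ∀ {n} (p : Fin n → Bool) → sumF (λ x → if p x then 1 else 0) ≡ count p
sumF-indicator {zero} p = refl
sumF-indicator {suc n} p = cong ((if p fz then 1 else 0) +_) (sumF-indicator (λ x → p (fs x)))

sumF-witness : ∀ {n} (f : Fin n → ℕ) → ¬ sumF f ≡ 0 → ∃[ x ] ¬ f x ≡ 0
sumF-witness {zero} f h = ⊥-elim (h refl)
sumF-witness {suc n} f h with f fz ≟ℕ 0
... | no nz = fz , nz
... | yes z = let (x , nx) = sumF-witness (λ x → f (fs x)) (λ e → h (trans (cong (_+ sumF (λ x → f (fs x))) z) e)) in fs x , nx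

countᵖ-single : ∀ {n} (x : Pair n) → countᵖ (λ y → y ==ᵖ x) ≡ 1
countᵖ-single {n} (a , b) = trans (sumF-cong _ _ row) (trans (sumF-indicator (λ i → i == a)) (count-single a))
  where
    row : ∀ i → count (λ j → (i == a) ∧ (j == b)) ≡ (if i == a then 1 else 0)
    row i with i == a
    ... | true = count-single b
    ... | false = count-none {n} (λ _ → false) (λ _ → refl)

countᵖ-cong : ∀ {n} (p q : Pair n → Bool) → (∀ x → p x ≡ q x) → countᵖ p ≡ countᵖ q
countᵖ-cong p q h = sumF-cong _ _ (λ a → count-cong _ _ (λ b → h (a , b)))

countᵖ-split : ∀ {n} (p q : Pair n → Bool) → countᵖ p ≡ countᵖ (λ x → p x ∧ q x) + countᵖ (λ x → p x ∧ not (q x))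
countᵖ-split p q = trans (sumF-cong _ _ (λ a → count-split (λ b → p (a , b)) (λ b → q (a , b))))
                         (sumF-+ (λ a → count (λ b → p (a , b) ∧ q (a , b))) (λ a → count (λ b → p (a , b) ∧ not (q (a , b)))))

countᵖ-none : ∀ {n} (p : Pair n → Bool) → (∀ x → p x ≡ false) → countᵖ p ≡ 0
countᵖ-none p h = sumF-none _ (λ a → count-none _ (λ b → h (a , b)))

countᵖ-witness : ∀ {n} (p : Pair n → Bool) → ¬ countᵖ p ≡ 0 → ∃[ x ] p x ≡ true
countᵖ-witness p h = let (a , nz) = sumF-witness _ h ; (b , pb) = count-witness _ nz in (a , b) , pb

pairCounting : ∀ n → Counting (Pair n)
pairCounting n = record
  { _≈ᵇ_ = _==ᵖ_ ; ≈ᵇ⇒≡ = ==ᵖ⇒≡ ; ≈ᵇ-refl = ==ᵖ-refl ; card = countᵖ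
  ; card-cong = countᵖ-cong ; card-split = countᵖ-split ; card-single = countᵖ-single
  ; card-none = countᵖ-none ; card-witness = countᵖ-witness }

module #Fin {n : ℕ} = CountingProperties (finCounting n)
module #Pair {n : ℕ} = CountingProperties (pairCounting n)

module _ {P : ℕ → Set} (P? : ∀ k → Dec (P k)) where

  least-or-none : ∀ m → (Σ ℕ λ k → P k × k ≤ m × (∀ j → j < k → ¬ P j)) ⊎ (∀ j → j ≤ m → ¬ P j)
  least-or-none zero with P? 0
  ... | yes p0 = inj₁ (0 , p0 , z≤n , λ j ())
  ... | no ¬p0 = inj₂ λ { zero _ → ¬p0 }
  least-or-none (suc m) with least-or-none m
  ... | inj₁ (k , pk , k≤m , below) = inj₁ (k , pk , m≤n⇒m≤1+n k≤m , below)
  ... | inj₂ none with P? (suc m)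
  ... | yes pm = inj₁ (suc m , pm , ≤-refl , λ j j<1+m → none j (≤-pred j<1+m))
  ... | no ¬pm = inj₂ λ j j≤1+m → [ (λ j<1+m → none j (≤-pred j<1+m)) , (λ { refl → ¬pm }) ]′ (m≤n⇒m<n∨m≡n j≤1+m)

  least-witness : ∀ m → P m → Σ ℕ λ k → P k × k ≤ m × (∀ j → j < k → ¬ P j)
  least-witness m pm with least-or-none m
  ... | inj₁ least = least
  ... | inj₂ none = ⊥-elim (none m ≤-refl pm)

argmin : ∀ k (f : Fin (suc k) → ℕ) → Σ (Fin (suc k)) λ i → ∀ j → f i ≤ f j
argmin zero f = fz , λ { fz → ≤-refl }
argmin (suc k) f with argmin k (λ j → f (fs j))
... | i , min with f fz ≤? f (fs i)
... | yes le = fz , λ { fz → ≤-refl ; (fs j) → ≤-trans le (min j) }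
... | no gt = fs i , λ { fz → <⇒≤ (≰⇒> gt) ; (fs j) → min j }

choose : ∀ {m} → (Fin m → Bool) → Fin m → Fin m
choose p default with any? (λ x → p x Bool.≟ true)
... | yes (x , _) = x
... | no _ = default

choose-spec : ∀ {m} (p : Fin m → Bool) default → anyF p ≡ true → p (choose p default) ≡ true
choose-spec p default h with any? (λ x → p x Bool.≟ true)
... | yes (_ , px) = px
... | no none = ⊥-elim (none (anyF⇒∃ p h))

least-vertex : ∀ {n} (p : Fin n → Bool) a → p a ≡ true → Σ (Fin n) λ m → p m ≡ true × (∀ x → p x ≡ true → toℕ m ≤ toℕ x)
least-vertex p a pa with least-witness (λ k → any? (λ x → (toℕ x ≟ℕ k) ×-dec (p x Bool.≟ true))) (toℕ a) (a , refl , pa)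
... | k , (m , refl , pm) , _ , below = m , pm , λ x px → ≮⇒≥ λ x<m → below (toℕ x) x<m (x , refl , px)

no-surjection : ∀ {k} (g : Fin k → Fin (suc k)) → ¬ (∀ c → ∃[ s ] g s ≡ c)
no-surjection {k} g onto with pigeonhole (n<1+n k) (λ c → proj₁ (onto c))
... | i , j , i<j , same = <-irrefl (cong toℕ (trans (sym (proj₂ (onto i))) (trans (cong g same) (proj₂ (onto j))))) i<j

missing-colour : ∀ {k} (g : Fin k → Fin (suc k)) → ∃[ c ] (∀ s → ¬ g s ≡ c)
missing-colour {k} g with ¬∀⟶∃¬ (suc k) (λ c → ∃[ s ] g s ≡ c) (λ c → any? (λ s → g s ≟ᶠ c)) (no-surjection g)
... | c , missed = c , λ s e → missed (s , e)

drop-repeat : ∀ {A : Set} {k} (f : Fin (suc k) → A) a b → ¬ a ≡ b → f a ≡ f b →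
              Σ (Fin k → A) λ g → ∀ s → ∃[ t ] f s ≡ g t
drop-repeat f a b a≢b fa≡fb = (λ t → f (punchIn a t)) , image
  where
    image : ∀ s → ∃[ t ] f s ≡ f (punchIn a t)
    image s with a ≟ᶠ s
    ... | yes refl = punchOut a≢b , trans fa≡fb (cong f (sym (punchIn-punchOut a≢b)))
    ... | no a≢s = punchOut a≢s , cong f (sym (punchIn-punchOut a≢s))

iter-+ : ∀ {X : Set} (f : X → X) a b x → iter f (a + b) x ≡ iter f a (iter f b x)
iter-+ f zero b x = refl
iter-+ f (suc a) b x = cong f (iter-+ f a b x)

iter-sucʳ : ∀ {X : Set} (f : X → X) k x → iter f (suc k) x ≡ iter f k (f x)
iter-sucʳ f zero x = refl
iter-sucʳ f (suc k) x = cong f (iter-sucʳ f k x)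

iter-* : ∀ {X : Set} (f : X → X) p s → iter f p s ≡ s → ∀ k → iter f (k * p) s ≡ s
iter-* f p s per zero = refl
iter-* f p s per (suc k) = trans (iter-+ f p (k * p) s) (trans (cong (iter f p) (iter-* f p s per k)) per)

iter-% : ∀ {X : Set} (f : X → X) p s → iter f p s ≡ s → .{{_ : NonZero p}} → ∀ m → iter f m s ≡ iter f (m % p) s
iter-% f p s per m = trans (cong (λ k → iter f k s) (m≡m%n+[m/n]*n m p))
  (trans (iter-+ f (m % p) ((m / p) * p) s) (cong (iter f (m % p)) (iter-* f p s per (m / p))))

record Period {X : Set} (f : X → X) (s : X) : Set where
  field
    p       : ℕ
    1≤p     : 1 ≤ p
    iter-p  : iter f p s ≡ s
    minimal : ∀ k → 1 ≤ k → k < p → ¬ iter f k s ≡ s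

period-≤ : ∀ {X : Set} → DecidableEquality X → (f : X → X) (s : X) (m : ℕ) → 1 ≤ m → iter f m s ≡ s →
           Σ (Period f s) λ P → Period.p P ≤ m
period-≤ _≟_ f s m 1≤m fᵐs≡s with least-witness (λ k → (1 ≤? k) ×-dec (iter f k s ≟ s)) m (1≤m , fᵐs≡s)
... | k , (1≤k , fᵏs≡s) , k≤m , below =
  record { p = k ; 1≤p = 1≤k ; iter-p = fᵏs≡s ; minimal = λ j 1≤j j<k e → below j j<k (1≤j , e) } , k≤m

module PeriodProperties {X : Set} {f : X → X} {s : X} (P : Period f s) where
  open Period P

  instance
    p-nonZero : NonZero p
    p-nonZero = ≢-nonZero (λ p≡0 → <-irrefl (sym p≡0) 1≤p)

  reduce : ∀ m → Σ ℕ λ k → k < p × iter f m s ≡ iter f k s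
  reduce m = m % p , m%n<n m p , iter-% f p s iter-p m

  distinct< : ∀ i j → i < j → j < p → ¬ iter f i s ≡ iter f j s
  distinct< i j i<j j<p e = minimal (p ∸ j + i) (≤-trans (m<n⇒0<n∸m j<p) (m≤m+n _ i)) shorter returns
    where
      shorter : p ∸ j + i < p
      shorter = begin-strict
          p ∸ j + i <⟨ +-monoʳ-< (p ∸ j) i<j ⟩
          p ∸ j + j ≡⟨ m∸n+n≡m (<⇒≤ j<p) ⟩
          p         ∎
        where open ≤-Reasoning
      returns : iter f (p ∸ j + i) s ≡ s
      returns = begin
          iter f (p ∸ j + i) s          ≡⟨ iter-+ f (p ∸ j) i s ⟩
          iter f (p ∸ j) (iter f i s)   ≡⟨ cong (iter f (p ∸ j)) e ⟩
          iter f (p ∸ j) (iter f j s)   ≡⟨ sym (iter-+ f (p ∸ j) j s) ⟩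
          iter f (p ∸ j + j) s          ≡⟨ cong (λ k → iter f k s) (m∸n+n≡m (<⇒≤ j<p)) ⟩
          iter f p s                    ≡⟨ iter-p ⟩
          s                             ∎
        where open ≡-Reasoning

  distinct : ∀ i j → i < p → j < p → iter f i s ≡ iter f j s → i ≡ j
  distinct i j i<p j<p e with <-cmp i j
  ... | tri< i<j _ _ = ⊥-elim (distinct< i j i<j j<p e)
  ... | tri≈ _ i≡j _ = i≡j
  ... | tri> _ _ j<i = ⊥-elim (distinct< j i j<i i<p (sym e))

  returns⇒last : ∀ k → k < p → f (iter f k s) ≡ s → suc k ≡ p
  returns⇒last k k<p e with <-cmp (suc k) p
  ... | tri< k+1<p _ _ = ⊥-elim (minimal (suc k) (s≤s z≤n) k+1<p e)
  ... | tri≈ _ k+1≡p _ = k+1≡p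
  ... | tri> _ _ p<k+1 = ⊥-elim (<-irrefl refl (≤-trans p<k+1 k<p))

  f-injective< : ∀ i j → i < j → j < p → ¬ f (iter f i s) ≡ f (iter f j s)
  f-injective< i j i<j j<p e with <-cmp (suc j) p
  ... | tri< j+1<p _ _ = distinct< (suc i) (suc j) (s≤s i<j) j+1<p e
  ... | tri≈ _ j+1≡p _ = minimal (suc i) (s≤s z≤n) (subst (suc i <_) j+1≡p (s≤s i<j))
                                 (trans e (subst (λ m → iter f m s ≡ s) (sym j+1≡p) iter-p))
  ... | tri> _ _ p<j+1 = <-irrefl refl (≤-trans p<j+1 j<p)

  f-injective : ∀ i j → i < p → j < p → f (iter f i s) ≡ f (iter f j s) → i ≡ j
  f-injective i j i<p j<p e with <-cmp i j
  ... | tri< i<j _ _ = ⊥-elim (f-injective< i j i<j j<p e)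
  ... | tri≈ _ i≡j _ = i≡j
  ... | tri> _ _ j<i = ⊥-elim (f-injective< j i j<i i<p (sym e))

orbit-enumerates : ∀ {X : Set} {g : X → X} {s : X} (P : Period g s) (C : Counting X) (q : X → Bool) →
                   (∀ k → q (iter g k s) ≡ true) → (∀ x → q x ≡ true → ∃[ k ] iter g k s ≡ x) →
                   Counting.card C q ≡ Period.p P
orbit-enumerates {g = g} {s} P C q inside covered = ≤-antisym
    (covered⇒card≤ p (λ i → iter g (toℕ i) s) q λ x qx →
      let (k , eₖ) = covered x qx ; (r , r<p , eᵣ) = PeriodProperties.reduce P k
      in fromℕ< r<p , trans (sym eₖ) (trans eᵣ (cong (λ m → iter g m s) (sym (toℕ-fromℕ< r<p)))))
    (injection⇒≤card p (λ i → iter g (toℕ i) s)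
      (λ i j e → toℕ-injective (PeriodProperties.distinct P (toℕ i) (toℕ j) (toℕ<n i) (toℕ<n j) e))
      q (λ i → inside (toℕ i)))
  where
    open CountingProperties C
    p : ℕ
    p = Period.p P

module RotationProperties (G : Graph) (R : Rotation G) where
  open Graph G using (n; adj)
  open Rotation R
  open Faces G R

  adj-sym : ∀ {x y} → adj x y ≡ true → adj y x ≡ true
  adj-sym {x} {y} h = trans (Graph.sym G y x) h

  abstract
    rot-period : ∀ y s → adj y s ≡ true → Period (rot y) s
    rot-period y s a with rot-cyc y (rot y s) s (rot-adj y s a) a
    ... | m , e = proj₁ (period-≤ _≟ᶠ_ (rot y) s (suc m) (s≤s z≤n) (trans (iter-sucʳ (rot y) m s) e))

  adj-iter-rot : ∀ y s → adj y s ≡ true → ∀ k → adj y (iter (rot y) k s) ≡ true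
  adj-iter-rot y s a zero = a
  adj-iter-rot y s a (suc k) = rot-adj y _ (adj-iter-rot y s a k)

  neighbour-index : ∀ y s (a : adj y s ≡ true) t → adj y t ≡ true →
                    Σ ℕ λ k → k < Period.p (rot-period y s a) × t ≡ iter (rot y) k s
  neighbour-index y s a t at with rot-cyc y s t a at
  ... | m , e = let (k , k<p , ek) = PeriodProperties.reduce (rot-period y s a) m in k , k<p , trans (sym e) ek

  rot-injective : ∀ y a b → adj y a ≡ true → adj y b ≡ true → rot y a ≡ rot y b → a ≡ b
  rot-injective y a b aa ab e with neighbour-index y a aa b ab
  ... | k , k<p , refl = cong (λ m → iter (rot y) m a)
        (PeriodProperties.f-injective (rot-period y a aa) 0 k (≤-trans (s≤s z≤n) k<p) k<p e)

  deg≡period : ∀ y s (a : adj y s ≡ true) → deg G y ≡ Period.p (rot-period y s a)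
  deg≡period y s a = orbit-enumerates (rot-period y s a) (finCounting n) (adj y) (adj-iter-rot y s a)
    λ t at → let (k , _ , e) = neighbour-index y s a t at in k , sym e

  isDart : Pair n → Bool
  isDart (a , b) = adj a b

  φ-isDart : ∀ d → isDart d ≡ true → isDart (φ d) ≡ true
  φ-isDart (a , b) h = rot-adj b a (adj-sym h)

  iter-φ-isDart : ∀ k d → isDart d ≡ true → isDart (iter φ k d) ≡ true
  iter-φ-isDart zero d h = h
  iter-φ-isDart (suc k) d h = φ-isDart _ (iter-φ-isDart k d h)

  φ-injective : ∀ d e → isDart d ≡ true → isDart e ≡ true → φ d ≡ φ e → d ≡ e
  φ-injective (a , b) (a' , b') h h' eq with cong proj₁ eq
  ... | refl = cong (_, b) (rot-injective b a a' (adj-sym h) (adj-sym h') (cong proj₂ eq))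

  iter-φ-cancel : ∀ i j d → isDart d ≡ true → iter φ i d ≡ iter φ (i + j) d → iter φ j d ≡ d
  iter-φ-cancel zero j d h e = sym e
  iter-φ-cancel (suc i) j d h e = iter-φ-cancel i j d h (φ-injective _ _ (iter-φ-isDart i d h) (iter-φ-isDart (i + j) d h) e)

  abstract
    face-period≤ : ∀ d → isDart d ≡ true → Σ (Period φ d) λ P → Period.p P ≤ n * n
    face-period≤ d h with pigeonhole (n<1+n (n * n)) (λ (k : Fin (suc (n * n))) → combine (proj₁ (iter φ (toℕ k) d)) (proj₂ (iter φ (toℕ k) d)))
    ... | i , j , i<j , e with combine-injective _ _ _ _ e
    ... | e₁ , e₂ = let (P , P≤) = period-≤ (≡-dec _≟ᶠ_ _≟ᶠ_) φ d (toℕ j ∸ toℕ i) (m<n⇒0<n∸m i<j)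
                                      (iter-φ-cancel (toℕ i) _ d h same)
                    in P , ≤-trans P≤ (≤-trans (m∸n≤m (toℕ j) (toℕ i)) (≤-pred (toℕ<n j)))
      where
        same : iter φ (toℕ i) d ≡ iter φ (toℕ i + (toℕ j ∸ toℕ i)) d
        same = trans (cong₂ _,_ e₁ e₂) (cong (λ m → iter φ m d) (sym (m+[n∸m]≡n (<⇒≤ i<j))))

  face-period : ∀ d → isDart d ≡ true → Period φ d
  face-period d h = proj₁ (face-period≤ d h)

  inFace⇒iter : ∀ d e → inFace d e ≡ true → Σ ℕ λ k → iter φ k d ≡ e
  inFace⇒iter d e h with anyF⇒∃ {suc (n * n)} (λ i → (G ≟ᵈ iter φ (toℕ i) d) e) h
  ... | i , eq = toℕ i , ==ᵖ⇒≡ eq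

  iter⇒inFace : ∀ d e → isDart d ≡ true → ∀ k → iter φ k d ≡ e → inFace d e ≡ true
  iter⇒inFace d e h k eq with PeriodProperties.reduce (face-period d h) k
  ... | r , r<p , eᵣ = ∃⇒anyF {suc (n * n)} (λ i → (G ≟ᵈ iter φ (toℕ i) d) e) (fromℕ< r<)
      (subst (λ m → iter φ m d ==ᵖ e ≡ true) (sym (toℕ-fromℕ< r<))
             (subst (λ x → x ==ᵖ e ≡ true) (trans (sym eq) eᵣ) (==ᵖ-refl e)))
    where
      r< : r < suc (n * n)
      r< = m≤n⇒m≤1+n (≤-trans r<p (proj₂ (face-period≤ d h)))

  inFace-refl : ∀ d → isDart d ≡ true → inFace d d ≡ true
  inFace-refl d h = iter⇒inFace d d h 0 refl

  inFace-isDart : ∀ d e → isDart d ≡ true → inFace d e ≡ true → isDart e ≡ true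
  inFace-isDart d e h i with inFace⇒iter d e i
  ... | k , refl = iter-φ-isDart k d h

  iter-φ-back : ∀ d e → isDart d ≡ true → ∀ k → iter φ k d ≡ e → Σ ℕ λ m → iter φ m e ≡ d
  iter-φ-back d e h k eq = k * p ∸ k , (begin
      iter φ (k * p ∸ k) e              ≡⟨ cong (iter φ (k * p ∸ k)) (sym eq) ⟩
      iter φ (k * p ∸ k) (iter φ k d)   ≡⟨ sym (iter-+ φ (k * p ∸ k) k d) ⟩
      iter φ (k * p ∸ k + k) d          ≡⟨ cong (λ m → iter φ m d) (m∸n+n≡m (m≤m*n k p)) ⟩
      iter φ (k * p) d                  ≡⟨ iter-* φ p d (Period.iter-p P) k ⟩
      d                                 ∎)
    where
      open ≡-Reasoning
      P : Period φ d
      P = face-period d h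
      p : ℕ
      p = Period.p P
      instance
        p≢0 : NonZero p
        p≢0 = PeriodProperties.p-nonZero P

  inFace-same : ∀ d e → isDart d ≡ true → inFace d e ≡ true → ∀ x → inFace e x ≡ inFace d x
  inFace-same d e h i x with inFace⇒iter d e i
  ... | k , eq with iter-φ-back d e h k eq
  ... | m , eq' = true-ext to from
    where
      to : inFace e x ≡ true → inFace d x ≡ true
      to t with inFace⇒iter e x t
      ... | j , ej = iter⇒inFace d x h (j + k) (trans (iter-+ φ j k d) (trans (cong (iter φ j) eq) ej))
      from : inFace d x ≡ true → inFace e x ≡ true
      from t with inFace⇒iter d x t
      ... | j , ej = iter⇒inFace e x (inFace-isDart d e h i) (j + m) (trans (iter-+ φ j m e) (trans (cong (iter φ j) eq') ej))

  key-injective : ∀ x y → key G x ≡ key G y → x ≡ y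
  key-injective (a , b) (c , d) e with combine-injective a b c d (toℕ-injective (begin
      toℕ (combine a b)    ≡⟨ toℕ-combine a b ⟩
      n * toℕ a + toℕ b    ≡⟨ cong (_+ toℕ b) (*-comm n (toℕ a)) ⟩
      key G (a , b)        ≡⟨ e ⟩
      key G (c , d)        ≡⟨ cong (_+ toℕ d) (*-comm (toℕ c) n) ⟩
      n * toℕ c + toℕ d    ≡⟨ toℕ-combine c d ⟨
      toℕ (combine c d)    ∎))
    where open ≡-Reasoning
  ... | refl , refl = refl

  isRep⇒min : ∀ d → isRep d ≡ true → isDart d ≡ true × (∀ x → inFace d x ≡ true → key G d ≤ key G x)
  isRep⇒min d h with ∧-elim {adj (proj₁ d) (proj₂ d)} h
  ... | dart , least = dart , λ { (u , w) i → below u w i (∨-elim (allF⇒∀ _ (allF⇒∀ _ least u) w)) }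
    where
      below : ∀ u w → inFace d (u , w) ≡ true →
              not (inFace d (u , w)) ≡ true ⊎ (key G d ≤ᵇ key G (u , w)) ≡ true → key G d ≤ key G (u , w)
      below u w i (inj₁ ni) = ⊥-elim (true⇒¬false i (not-true⇒false ni))
      below u w i (inj₂ le) = ≤ᵇ⇒≤ _ _ (subst T (sym le) _)

  min⇒isRep : ∀ d → isDart d ≡ true → (∀ x → inFace d x ≡ true → key G d ≤ key G x) → isRep d ≡ true
  min⇒isRep d dart least = ∧-intro dart (∀⇒allF _ λ u → ∀⇒allF _ λ w → below u w)
    where
      below : ∀ u w → (not (inFace d (u , w)) ∨ (key G d ≤ᵇ key G (u , w))) ≡ true
      below u w with inFace d (u , w) in e
      ... | true = T⇒≡true (≤⇒≤ᵇ (least (u , w) e))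
      ... | false = refl

  isRep-unique : ∀ d d' e → isRep d ≡ true → isRep d' ≡ true → inFace d e ≡ true → inFace d' e ≡ true → d ≡ d'
  isRep-unique d d' e r r' i i' = key-injective d d' (≤-antisym (key≤ d d' r r' i i') (key≤ d' d r' r i' i))
    where
      key≤ : ∀ d d' → isRep d ≡ true → isRep d' ≡ true → inFace d e ≡ true → inFace d' e ≡ true → key G d ≤ key G d'
      key≤ d d' r r' i i' = let (dart , least) = isRep⇒min d r ; (dart' , _) = isRep⇒min d' r' in
        least d' (trans (sym (inFace-same d e dart i d')) (trans (inFace-same d' e dart' i' d') (inFace-refl d' dart')))

  face-rep : ∀ d → isDart d ≡ true → Σ (Pair n) λ r → isRep r ≡ true × inFace d r ≡ true
  face-rep d h = r , min⇒isRep r (iter-φ-isDart (toℕ i) d h) least , iter⇒inFace d r h (toℕ i) refl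
    where
      P : Period φ d
      P = face-period d h
      p-1 : ℕ
      p-1 = Period.p P ∸ 1
      p≡ : suc p-1 ≡ Period.p P
      p≡ = m+[n∸m]≡n (Period.1≤p P)
      am : Σ (Fin (suc p-1)) λ i → ∀ j → key G (iter φ (toℕ i) d) ≤ key G (iter φ (toℕ j) d)
      am = argmin p-1 (λ j → key G (iter φ (toℕ j) d))
      i : Fin (suc p-1)
      i = proj₁ am
      r : Pair n
      r = iter φ (toℕ i) d
      least : ∀ x → inFace r x ≡ true → key G r ≤ key G x
      least x t with inFace⇒iter r x t
      ... | k , eₖ =
        let (k' , k'<p , e') = PeriodProperties.reduce P (k + toℕ i)
            k'<p' = subst (k' <_) (sym p≡) k'<p
        in subst (λ z → key G r ≤ key G z)
             (trans (cong (λ m → iter φ m d) (toℕ-fromℕ< k'<p')) (trans (sym e') (trans (iter-+ φ k (toℕ i) d) eₖ)))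
             (proj₂ am (fromℕ< k'<p'))

  faceDeg-same : ∀ d e → isDart d ≡ true → inFace d e ≡ true → faceDeg e ≡ faceDeg d
  faceDeg-same d e h i = countᵖ-cong _ _ (λ x → cong (isDart x ∧_) (inFace-same d e h i x))

  faceDeg≡period : ∀ d (h : isDart d ≡ true) → faceDeg d ≡ Period.p (face-period d h)
  faceDeg≡period d h = orbit-enumerates (face-period d h) (pairCounting n) (λ x → isDart x ∧ inFace d x)
    (λ k → ∧-intro (iter-φ-isDart k d h) (iter⇒inFace d _ h k refl))
    (λ x t → inFace⇒iter d x (proj₂ (∧-elim {isDart x} t)))

  triangle-φ³ : ∀ d → isDart d ≡ true → faceDeg d ≡ 3 → iter φ 3 d ≡ d
  triangle-φ³ d h f3 = subst (λ k → iter φ k d ≡ d) (trans (sym (faceDeg≡period d h)) f3) (Period.iter-p (face-period d h))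

  triangle-rot : ∀ y x → adj y x ≡ true → iter φ 3 (y , x) ≡ (y , x) →
                 rot (rot x y) x ≡ y × rot y (rot x y) ≡ x × adj y (rot x y) ≡ true
  triangle-rot y x h e = e₁ , trans (cong (λ z → rot z (rot x y)) (sym e₁)) (cong proj₂ e) , ya
    where
      a : Fin n
      a = rot x y
      e₁ : rot a x ≡ y
      e₁ = cong proj₁ e
      ya : adj y a ≡ true
      ya = adj-sym (subst (λ z → adj a z ≡ true) e₁ (rot-adj a x (adj-sym (rot-adj x y (adj-sym h)))))

  triangle-adj : ∀ y x → adj y x ≡ true → faceDeg (y , rot y x) ≡ 3 → adj x (rot y x) ≡ true
  triangle-adj y x yx f3 = subst (λ z → adj z x' ≡ true) a≡x (adj-sym (rot-adj x' y (adj-sym yx')))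
    where
      x' : Fin n
      x' = rot y x
      yx' : adj y x' ≡ true
      yx' = rot-adj y x yx
      t : rot (rot x' y) x' ≡ y × rot y (rot x' y) ≡ x' × adj y (rot x' y) ≡ true
      t = triangle-rot y x' yx' (triangle-φ³ (y , x') yx' f3)
      a≡x : rot x' y ≡ x
      a≡x = rot-injective y (rot x' y) x (proj₂ (proj₂ t)) yx (proj₁ (proj₂ t))

  facesOfDegAt≤ : ∀ k y → facesOfDegAt k y ≤ count (λ x → adj y x ∧ (faceDeg (y , x) ≡ᵇ k))
  facesOfDegAt≤ k y = injection⇒card≤card (pairCounting n) (finCounting n) P Q g PQ g-injective
    where
      incident : Pair n → Fin n → Bool
      incident d x = adj y x ∧ inFace d (y , x)
      P : Pair n → Bool
      P d = isRep d ∧ (faceDeg d ≡ᵇ k) ∧ anyF (incident d)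
      Q : Fin n → Bool
      Q x = adj y x ∧ (faceDeg (y , x) ≡ᵇ k)
      g : Pair n → Fin n
      g d = choose (incident d) y
      g-incident : ∀ d → P d ≡ true → incident d (g d) ≡ true
      g-incident d t = choose-spec (incident d) y (proj₂ (∧-elim {faceDeg d ≡ᵇ k} (proj₂ (∧-elim {isRep d} t))))
      PQ : ∀ d → P d ≡ true → Q (g d) ≡ true
      PQ d t = let (r , t₂) = ∧-elim {isRep d} t
                   (dk , _) = ∧-elim {faceDeg d ≡ᵇ k} t₂
                   (ag , ig) = ∧-elim {adj y (g d)} (g-incident d t)
               in ∧-intro ag (trans (cong (_≡ᵇ k) (faceDeg-same d (y , g d) (proj₁ (isRep⇒min d r)) ig)) dk)
      g-injective : ∀ d d' → P d ≡ true → P d' ≡ true → g d ≡ g d' → d ≡ d'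
      g-injective d d' t t' e = isRep-unique d d' (y , g d) (proj₁ (∧-elim {isRep d} t)) (proj₁ (∧-elim {isRep d'} t'))
          (proj₂ (∧-elim {adj y (g d)} (g-incident d t)))
          (subst (λ z → inFace d' (y , z) ≡ true) (sym e) (proj₂ (∧-elim {adj y (g d')} (g-incident d' t'))))

  faces-enumerated : ∀ (S : Pair n → Bool) k (s : Fin k → Pair n) → (∀ i → isDart (s i) ≡ true) →
                     (∀ d → isDart d ≡ true → S d ≡ true → ∃[ i ] inFace (s i) d ≡ true) →
                     (∀ i d → inFace (s i) d ≡ true → S d ≡ true) →
                     (∀ i j → inFace (s i) (s j) ≡ true → i ≡ j) →
                     countᵖ (λ d → isRep d ∧ S d) ≡ k
  faces-enumerated S k s dart cover within distinct = ≤-antisym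
      (#Pair.covered⇒card≤ k rep _ λ d t →
        let (r , Sd) = ∧-elim {isRep d} t
            dd = proj₁ (isRep⇒min d r)
            (i , i∋d) = cover d dd Sd
        in i , isRep-unique d (rep i) d r (rep-isRep i) (inFace-refl d dd)
                 (trans (inFace-same (s i) (rep i) (dart i) (rep-in i) d) i∋d))
      (#Pair.injection⇒≤card k rep rep-injective _ λ i → ∧-intro (rep-isRep i) (within i (rep i) (rep-in i)))
    where
      rep : Fin k → Pair n
      rep i = proj₁ (face-rep (s i) (dart i))
      rep-isRep : ∀ i → isRep (rep i) ≡ true
      rep-isRep i = proj₁ (proj₂ (face-rep (s i) (dart i)))
      rep-in : ∀ i → inFace (s i) (rep i) ≡ true
      rep-in i = proj₂ (proj₂ (face-rep (s i) (dart i)))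
      rep-injective : ∀ i j → rep i ≡ rep j → i ≡ j
      rep-injective i j e = distinct i j (begin
          inFace (s i) (s j)      ≡⟨ inFace-same (s i) (rep i) (dart i) (rep-in i) (s j) ⟨
          inFace (rep i) (s j)    ≡⟨ cong (λ d → inFace d (s j)) e ⟩
          inFace (rep j) (s j)    ≡⟨ inFace-same (s j) (rep j) (dart j) (rep-in j) (s j) ⟩
          inFace (s j) (s j)      ≡⟨ inFace-refl (s j) (dart j) ⟩
          true                    ∎)
        where open ≡-Reasoning

module Reachability (G : Graph) where
  open Graph G using (n; adj)

  reach-step : ∀ k u x w → reach G k u x ≡ true → adj x w ≡ true → reach G (suc k) u w ≡ true
  reach-step k u x w r a = ∨-introʳ {reach G k u w} (∃⇒anyF (λ y → reach G k u y ∧ adj y w) x (∧-intro r a))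

  reach-suc : ∀ k u w → reach G k u w ≡ true → reach G (suc k) u w ≡ true
  reach-suc k u w r = ∨-introˡ r

  reach-≤ : ∀ k m u w → k ≤ m → reach G k u w ≡ true → reach G m u w ≡ true
  reach-≤ k m u w k≤m r with m≤n⇒m<n∨m≡n k≤m
  ... | inj₂ refl = r
  reach-≤ k (suc m) u w k≤m r | inj₁ (s≤s k≤m') = reach-suc m u w (reach-≤ k m u w k≤m' r)

  reach-refl : ∀ k u → reach G k u u ≡ true
  reach-refl zero u = ==-refl u
  reach-refl (suc k) u = reach-suc k u u (reach-refl k u)

  reach-unstep : ∀ k u w → reach G (suc k) u w ≡ true →
                 reach G k u w ≡ true ⊎ (Σ (Fin n) λ x → reach G k u x ≡ true × adj x w ≡ true)
  reach-unstep k u w r with ∨-elim {reach G k u w} r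
  ... | inj₁ r' = inj₁ r'
  ... | inj₂ r' = let (x , t) = anyF⇒∃ _ r' in inj₂ (x , ∧-elim {reach G k u x} t)

  reach-cons : ∀ k u x w → adj u x ≡ true → reach G k x w ≡ true → reach G (suc k) u w ≡ true
  reach-cons zero u x w a r rewrite ==⇒≡ {a = x} {w} r = reach-step 0 u u w (reach-refl 0 u) a
  reach-cons (suc k) u x w a r with reach-unstep k x w r
  ... | inj₁ r' = reach-suc (suc k) u w (reach-cons k u x w a r')
  ... | inj₂ (z , rz , az) = reach-step (suc k) u z w (reach-cons k u x z a rz) az

  reach-trans : ∀ k m u x w → reach G k u x ≡ true → reach G m x w ≡ true → reach G (m + k) u w ≡ true
  reach-trans k zero u x w r₁ r₂ rewrite ==⇒≡ {a = x} {w} r₂ = r₁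
  reach-trans k (suc m) u x w r₁ r₂ with reach-unstep m x w r₂
  ... | inj₁ r' = reach-suc (m + k) u w (reach-trans k m u x w r₁ r')
  ... | inj₂ (z , rz , az) = reach-step (m + k) u z w (reach-trans k m u x z r₁ rz) az

  reach-sym : ∀ k u w → reach G k u w ≡ true → reach G k w u ≡ true
  reach-sym zero u w r rewrite ==⇒≡ {a = u} {w} r = ==-refl w
  reach-sym (suc k) u w r with reach-unstep k u w r
  ... | inj₁ r' = reach-suc k w u (reach-sym k u w r')
  ... | inj₂ (z , rz , az) = reach-cons k w z u (trans (Graph.sym G w z) az) (reach-sym k u z rz)

  reach-isolated : ∀ k u w → (∀ x → adj u x ≡ false) → reach G k u w ≡ true → u ≡ w
  reach-isolated zero u w h r = ==⇒≡ r
  reach-isolated (suc k) u w h r with reach-unstep k u w r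
  ... | inj₁ r' = reach-isolated k u w h r'
  ... | inj₂ (z , rz , az) with reach-isolated k u z h rz
  ... | refl = ⊥-elim (true⇒¬false az (h w))

  stable : Fin n → ℕ → Bool
  stable u j = allF (λ y → not (reach G (suc j) u y) ∨ reach G j u y)

  stable⇒closed : ∀ u j → stable u j ≡ true → ∀ m y → reach G (m + j) u y ≡ true → reach G j u y ≡ true
  stable⇒closed u j st zero y r = r
  stable⇒closed u j st (suc m) y r with reach-unstep (m + j) u y r
  ... | inj₁ r' = stable⇒closed u j st m y r'
  ... | inj₂ (z , rz , az) with ∨-elim {not (reach G (suc j) u y)} (allF⇒∀ _ st y)
  ... | inj₁ unreached = ⊥-elim (true⇒¬false (reach-step j u z y (stable⇒closed u j st m z rz) az) (not-true⇒false unreached))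
  ... | inj₂ reached = reached

  grows-or-stable : ∀ u k → (suc k ≤ count (reach G k u)) ⊎ (Σ ℕ λ j → j ≤ k × stable u j ≡ true)
  grows-or-stable u zero = inj₁ (#Fin.injection⇒≤card 1 (λ _ → u) (λ { fz fz _ → refl }) _ (λ _ → reach-refl 0 u))
  grows-or-stable u (suc k) with grows-or-stable u k
  ... | inj₂ (j , j≤k , st) = inj₂ (j , m≤n⇒m≤1+n j≤k , st)
  ... | inj₁ grows with stable u k in e
  ... | true = inj₂ (k , n≤1+n k , e)
  ... | false with allF-false⇒∃ _ e
  ... | y , new = inj₁ (≤-trans (s≤s grows) (#Fin.card-< (reach G k u) (reach G (suc k) u) y (reach-suc k u) (proj₂ fresh) (proj₁ fresh)))
    where
      split : ∀ {a b} → (not a ∨ b) ≡ false → a ≡ true × b ≡ false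
      split {true} {false} _ = refl , refl
      fresh : reach G (suc k) u y ≡ true × reach G k u y ≡ false
      fresh = split {reach G (suc k) u y} new

  reach-stabilises : ∀ k u w → reach G k u w ≡ true → reach G n u w ≡ true
  reach-stabilises k u w r with grows-or-stable u n
  ... | inj₁ grows = ⊥-elim (1+n≰n (≤-trans grows (count-≤ (reach G n u))))
  ... | inj₂ (j , j≤n , st) with ≤-total k n
  ... | inj₁ k≤n = reach-≤ k n u w k≤n r
  ... | inj₂ n≤k = reach-≤ j n u w j≤n (stable⇒closed u j st (k ∸ j) w
                     (subst (λ m → reach G m u w ≡ true) (sym (m∸n+n≡m (≤-trans j≤n n≤k))) r))

  reach-trans-n : ∀ x y z → reach G n x y ≡ true → reach G n y z ≡ true → reach G n x z ≡ true
  reach-trans-n x y z r₁ r₂ = reach-stabilises (n + n) x z (reach-trans n n x y z r₁ r₂)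

  isLeader : Fin n → Bool
  isLeader x = allF (λ w → not (reach G n x w) ∨ (toℕ x ≤ᵇ toℕ w))

  isLeader⇒≤ : ∀ x → isLeader x ≡ true → ∀ w → reach G n x w ≡ true → toℕ x ≤ toℕ w
  isLeader⇒≤ x h w r with ∨-elim {not (reach G n x w)} (allF⇒∀ _ h w)
  ... | inj₁ unreached = ⊥-elim (true⇒¬false r (not-true⇒false unreached))
  ... | inj₂ x≤w = ≤ᵇ⇒≤ (toℕ x) (toℕ w) (≡true⇒T x≤w)

  ≤⇒isLeader : ∀ x → (∀ w → reach G n x w ≡ true → toℕ x ≤ toℕ w) → isLeader x ≡ true
  ≤⇒isLeader x h = ∀⇒allF _ below
    where
      below : ∀ w → (not (reach G n x w) ∨ (toℕ x ≤ᵇ toℕ w)) ≡ true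
      below w with reach G n x w in r
      ... | false = refl
      ... | true = T⇒≡true (≤⇒≤ᵇ (h w r))

  ¬isLeader⇒smaller : ∀ x → isLeader x ≡ false → Σ (Fin n) λ w → reach G n x w ≡ true × toℕ w < toℕ x
  ¬isLeader⇒smaller x h with allF-false⇒∃ _ h
  ... | w , e = w , split e
    where
      split : (not (reach G n x w) ∨ (toℕ x ≤ᵇ toℕ w)) ≡ false → reach G n x w ≡ true × toℕ w < toℕ x
      split e with reach G n x w | toℕ x ≤ᵇ toℕ w in x≤w
      ... | true | false = refl , ≰⇒> (λ le → true⇒¬false (T⇒≡true (≤⇒≤ᵇ le)) x≤w)

  leader-unique : ∀ x y → isLeader x ≡ true → reach G n x y ≡ true → toℕ y ≤ toℕ x → x ≡ y
  leader-unique x y lx r y≤x = toℕ-injective (≤-antisym (isLeader⇒≤ x lx y r) y≤x)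

adj⇒deg≢0 : ∀ (K : Graph) x y → Graph.adj K x y ≡ true → ¬ deg K x ≡ 0
adj⇒deg≢0 K x y xy e = <-irrefl (sym e) (#Fin.injection⇒≤card 1 (λ _ → y) (λ { fz fz _ → refl }) (Graph.adj K x) (λ _ → xy))

isIsolated-adj : ∀ (K : Graph) x y → Graph.adj K x y ≡ true → (deg K x ≡ᵇ 0) ≡ false
isIsolated-adj K x y xy with deg K x in e
... | zero = ⊥-elim (adj⇒deg≢0 K x y xy e)
... | suc _ = refl

Dist≤2-sym : ∀ (G : Graph) x y → Dist≤2 G x y → Dist≤2 G y x
Dist≤2-sym G x y (x≢y , inj₁ xy) = (λ e → x≢y (sym e)) , inj₁ (trans (Graph.sym G y x) xy)
Dist≤2-sym G x y (x≢y , inj₂ (z , xz , zy)) = (λ e → x≢y (sym e)) , inj₂ (z , trans (Graph.sym G y z) zy , trans (Graph.sym G z x) xz)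

-- H keeps v, now isolated, so that both graphs live on Fin n; the rotation at
-- every other vertex skips v.
module EdgeDeletion (G : Graph) (R : Rotation G) (v : Fin (Graph.n G)) where
  open Graph G using (n; adj; irrefl)
  open Rotation R
  open RotationProperties G R

  adjH : Fin n → Fin n → Bool
  adjH a b = adj a b ∧ not (a == v) ∧ not (b == v)

  adjH-sym : ∀ a b → adjH a b ≡ adjH b a
  adjH-sym a b rewrite Graph.sym G a b with adj b a
  ... | false = refl
  ... | true with a == v | b == v
  ... | true | true = refl
  ... | true | false = refl
  ... | false | true = refl
  ... | false | false = refl

  H : Graph
  H = record { n = n ; adj = adjH ; sym = adjH-sym ; irrefl = λ a → cong (_∧ (not (a == v) ∧ not (a == v))) (irrefl a) }

  adjH⇒adj : ∀ {a b} → adjH a b ≡ true → adj a b ≡ true × ¬ a ≡ v × ¬ b ≡ v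
  adjH⇒adj {a} {b} h with ∧-elim {adj a b} h
  ... | ab , rest with ∧-elim {not (a == v)} rest
  ... | a≉v , b≉v = ab , ==false⇒≢ (not-true⇒false a≉v) , ==false⇒≢ (not-true⇒false b≉v)

  adj⇒adjH : ∀ {a b} → adj a b ≡ true → ¬ a ≡ v → ¬ b ≡ v → adjH a b ≡ true
  adj⇒adjH ab a≢v b≢v = ∧-intro ab (∧-intro (false⇒not-true (≢⇒==false a≢v)) (false⇒not-true (≢⇒==false b≢v)))

  v-isolatedH : ∀ x → adjH v x ≡ false
  v-isolatedH x = ¬true⇒false λ h → proj₁ (proj₂ (adjH⇒adj {v} {x} h)) refl

  rotH : Fin n → Fin n → Fin n
  rotH y x = if rot y x == v then rot y v else rot y x

  rotH-≢ : ∀ y x → ¬ rot y x ≡ v → rotH y x ≡ rot y x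
  rotH-≢ y x ne rewrite ≢⇒==false ne = refl

  rotH-≡ : ∀ y x → rot y x ≡ v → rotH y x ≡ rot y v
  rotH-≡ y x e rewrite e | ==-refl v = refl

  rotH-adj : ∀ y x → adjH y x ≡ true → adjH y (rotH y x) ≡ true
  rotH-adj y x h with adjH⇒adj {y} {x} h
  ... | yx , y≢v , x≢v with rot y x == v in e
  ... | false = adj⇒adjH (rot-adj y x yx) y≢v (==false⇒≢ e)
  ... | true = adj⇒adjH (rot-adj y v yv) y≢v rot-v≢v
    where
      yv : adj y v ≡ true
      yv = subst (λ z → adj y z ≡ true) (==⇒≡ e) (rot-adj y x yx)
      fixed : rot y v ≡ v → ∀ k → iter (rot y) k v ≡ v
      fixed e zero = refl
      fixed e (suc k) rewrite fixed e k = e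
      rot-v≢v : ¬ rot y v ≡ v
      rot-v≢v e = let (k , _ , ex) = neighbour-index y v yv x yx in x≢v (trans ex (fixed e k))

  rotH-away : ∀ y x → adj y v ≡ false → adj y x ≡ true → ∀ k → iter (rotH y) k x ≡ iter (rot y) k x
  rotH-away y x yv yx zero = refl
  rotH-away y x yv yx (suc k) rewrite rotH-away y x yv yx k = rotH-≢ y _ λ e →
    true⇒¬false (subst (λ z → adj y z ≡ true) e (rot-adj y _ (adj-iter-rot y x yx k))) yv

  module AtNeighbour (y : Fin n) (yv : adj y v ≡ true) where
    P : Period (rot y) v
    P = rot-period y v yv
    p : ℕ
    p = Period.p P

    E : ℕ → Fin n
    E k = iter (rot y) k v

    walk : ∀ a m → 1 ≤ a → a + m < p → iter (rotH y) m (E a) ≡ E (a + m)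
    walk a zero _ _ = cong E (sym (+-identityʳ a))
    walk a (suc m) 1≤a a+m<p = begin
        rotH y (iter (rotH y) m (E a))  ≡⟨ cong (rotH y) (walk a m 1≤a (<-trans (+-monoʳ-< a (n<1+n m)) a+m<p)) ⟩
        rotH y (E (a + m))              ≡⟨ rotH-≢ y _ (Period.minimal P (suc (a + m)) (s≤s z≤n) (subst (_< p) (+-suc a m) a+m<p)) ⟩
        E (suc (a + m))                 ≡⟨ cong E (sym (+-suc a m)) ⟩
        E (a + suc m)                   ∎
      where open ≡-Reasoning

    p-1+1 : suc (p ∸ 1) ≡ p
    p-1+1 = m+[n∸m]≡n (Period.1≤p P)

    wrap : rotH y (E (p ∸ 1)) ≡ E 1
    wrap = rotH-≡ y _ (trans (cong E p-1+1) (Period.iter-p P))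

    index : ∀ z → adj y z ≡ true → ¬ z ≡ v → Σ ℕ λ k → 1 ≤ k × k < p × z ≡ E k
    index z yz z≢v with neighbour-index y v yv z yz
    ... | zero , _ , e = ⊥-elim (z≢v e)
    ... | suc k , k<p , e = suc k , s≤s z≤n , k<p , e

    forward : ∀ a b → 1 ≤ a → a ≤ b → b < p → iter (rotH y) (b ∸ a) (E a) ≡ E b
    forward a b 1≤a a≤b b<p =
      trans (walk a (b ∸ a) 1≤a (subst (_< p) (sym (m+[n∸m]≡n a≤b)) b<p)) (cong E (m+[n∸m]≡n a≤b))

    around : ∀ a b → 1 ≤ a → 1 ≤ b → a < p → iter (rotH y) ((b ∸ 1) + (1 + (p ∸ 1 ∸ a))) (E a) ≡ iter (rotH y) (b ∸ 1) (E 1)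
    around a b 1≤a 1≤b a<p = begin
        iter (rotH y) ((b ∸ 1) + (1 + (p ∸ 1 ∸ a))) (E a)                 ≡⟨ iter-+ (rotH y) (b ∸ 1) (1 + (p ∸ 1 ∸ a)) (E a) ⟩
        iter (rotH y) (b ∸ 1) (rotH y (iter (rotH y) (p ∸ 1 ∸ a) (E a)))  ≡⟨ cong (λ z → iter (rotH y) (b ∸ 1) (rotH y z)) to-last ⟩
        iter (rotH y) (b ∸ 1) (rotH y (E (p ∸ 1)))                        ≡⟨ cong (iter (rotH y) (b ∸ 1)) wrap ⟩
        iter (rotH y) (b ∸ 1) (E 1)                                       ∎
      where
        open ≡-Reasoning
        to-last : iter (rotH y) (p ∸ 1 ∸ a) (E a) ≡ E (p ∸ 1)
        to-last = forward a (p ∸ 1) 1≤a (≤-pred (subst (a <_) (sym p-1+1) a<p)) (subst (p ∸ 1 <_) p-1+1 ≤-refl)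

    rotH-cyclic : ∀ x w → adjH y x ≡ true → adjH y w ≡ true → ∃[ k ] iter (rotH y) k x ≡ w
    rotH-cyclic x w hx hw with adjH⇒adj {y} {x} hx | adjH⇒adj {y} {w} hw
    ... | yx , _ , x≢v | yw , _ , w≢v with index x yx x≢v | index w yw w≢v
    ... | a , 1≤a , a<p , refl | b , 1≤b , b<p , refl with ≤-total a b
    ... | inj₁ a≤b = b ∸ a , forward a b 1≤a a≤b b<p
    ... | inj₂ _ = (b ∸ 1) + (1 + (p ∸ 1 ∸ a)) , trans (around a b 1≤a 1≤b a<p) (forward 1 b ≤-refl 1≤b b<p)

  rotH-cyc : ∀ y x w → adjH y x ≡ true → adjH y w ≡ true → ∃[ k ] iter (rotH y) k x ≡ w
  rotH-cyc y x w hx hw with adj y v in yv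
  ... | true = AtNeighbour.rotH-cyclic y yv x w hx hw
  ... | false = let (yx , _) = adjH⇒adj {y} {x} hx ; (yw , _) = adjH⇒adj {y} {w} hw
                    (k , eₖ) = rot-cyc y x w yx yw
                in k , trans (rotH-away y x yv yx k) eₖ

  RH : Rotation H
  RH = record { rot = rotH ; rot-adj = rotH-adj ; rot-cyc = rotH-cyc }

  degH≤deg : ∀ x → deg H x ≤ deg G x
  degH≤deg x = #Fin.card-mono (adjH x) (adj x) (λ y h → proj₁ (adjH⇒adj {x} {y} h))

  degH-v : deg H v ≡ 0
  degH-v = count-none (adjH v) v-isolatedH

  degH-away : ∀ x → adj x v ≡ false → ¬ x ≡ v → deg H x ≡ deg G x
  degH-away x xv x≢v = count-cong (adjH x) (adj x) same
    where
      same : ∀ y → adjH x y ≡ adj x y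
      same y with adj x y in xy
      ... | false = refl
      ... | true = ∧-intro (false⇒not-true (≢⇒==false x≢v))
                           (false⇒not-true (≢⇒==false λ y≡v → true⇒¬false (subst (λ z → adj x z ≡ true) y≡v xy) xv))

  reachH⇒reachG : ∀ k x y → reach H k x y ≡ true → reach G k x y ≡ true
  reachH⇒reachG zero x y r = r
  reachH⇒reachG (suc k) x y r with Reachability.reach-unstep H k x y r
  ... | inj₁ r' = Reachability.reach-suc G k x y (reachH⇒reachG k x y r')
  ... | inj₂ (z , rz , zy) = Reachability.reach-step G k x z y (reachH⇒reachG k x z rz) (proj₁ (adjH⇒adj {z} {y} zy))

  _<ᶠ_ : Fin n → Fin n → Bool
  a <ᶠ b = toℕ a <ᵇ toℕ b

  edge : (Fin n → Fin n → Bool) → Pair n → Bool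
  edge E (a , b) = E a b ∧ (a <ᶠ b)

  touches-v : Pair n → Bool
  touches-v (a , b) = (a == v) ∨ (b == v)

  edgeH≡edge∖touches : ∀ d → edge adjH d ≡ (edge adj d ∧ not (touches-v d))
  edgeH≡edge∖touches (a , b) = reassoc (adj a b) (a <ᶠ b) (a == v) (b == v)
    where
      reassoc : ∀ e l x y → ((e ∧ not x ∧ not y) ∧ l) ≡ ((e ∧ l) ∧ not (x ∨ y))
      reassoc false l x y = refl
      reassoc true false x y = ∧-zeroʳ (not x ∧ not y)
      reassoc true true false false = refl
      reassoc true true false true = refl
      reassoc true true true y = refl

  <ᶠ-total : ∀ x → ¬ x ≡ v → v <ᶠ x ≡ false → x <ᶠ v ≡ true
  <ᶠ-total x x≢v ¬v<x = T⇒≡true (<⇒<ᵇ (≤∧≢⇒< (≮⇒≥ λ v<x → true⇒¬false (T⇒≡true (<⇒<ᵇ v<x)) ¬v<x)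
                                             λ e → x≢v (toℕ-injective e)))

  <ᶠ-asym : ∀ a b → a <ᶠ b ≡ true → ¬ b <ᶠ a ≡ true
  <ᶠ-asym a b a<b b<a = <-asym (<ᵇ⇒< (toℕ a) (toℕ b) (≡true⇒T a<b)) (<ᵇ⇒< (toℕ b) (toℕ a) (≡true⇒T b<a))

  private
    touching : Pair n → Bool
    touching d = edge adj d ∧ touches-v d

    ordered : Fin n → Pair n
    ordered x = if v <ᶠ x then (v , x) else (x , v)

    other : Pair n → Fin n
    other (a , b) = if a == v then b else a

    ordered-touching : ∀ x → adj v x ≡ true → touching (ordered x) ≡ true
    ordered-touching x vx with v <ᶠ x in v<x
    ... | true = ∧-intro (∧-intro vx v<x) (∨-introˡ (==-refl v))
    ... | false = ∧-intro (∧-intro (adj-sym vx) (<ᶠ-total x x≢v v<x)) (∨-introʳ {x == v} (==-refl v))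
      where
        x≢v : ¬ x ≡ v
        x≢v x≡v = true⇒¬false (subst (λ z → adj v z ≡ true) x≡v vx) (irrefl v)

    ordered-injective : ∀ x y → adj v x ≡ true → adj v y ≡ true → ordered x ≡ ordered y → x ≡ y
    ordered-injective x y vx vy e with v <ᶠ x | v <ᶠ y
    ... | true | true = cong proj₂ e
    ... | true | false = ⊥-elim (true⇒¬false vx (subst (λ z → adj v z ≡ false) (sym (cong proj₂ e)) (irrefl v)))
    ... | false | true = ⊥-elim (true⇒¬false vy (subst (λ z → adj v z ≡ false) (cong proj₂ e) (irrefl v)))
    ... | false | false = cong proj₁ e

    touching-shape : ∀ a b → touching (a , b) ≡ true →
                     (a ≡ v × other (a , b) ≡ b × v <ᶠ b ≡ true) ⊎ (b ≡ v × other (a , b) ≡ a × a <ᶠ v ≡ true)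
    touching-shape a b t with ∧-elim {edge adj (a , b)} t
    ... | ab<b , touch with ∧-elim {adj a b} ab<b
    ... | _ , a<b with a == v in a≈v
    ... | true = inj₁ (==⇒≡ a≈v , refl , subst (λ z → z <ᶠ b ≡ true) (==⇒≡ a≈v) a<b)
    ... | false with ∨-elim {false} touch
    ... | inj₂ b≈v = inj₂ (==⇒≡ b≈v , refl , subst (λ z → a <ᶠ z ≡ true) (==⇒≡ b≈v) a<b)

    touching-other : ∀ d → touching d ≡ true → adj v (other d) ≡ true
    touching-other (a , b) t with ∧-elim {adj a b} (proj₁ (∧-elim {edge adj (a , b)} t)) | touching-shape a b t
    ... | ab , _ | inj₁ (refl , o≡b , _) = subst (λ z → adj v z ≡ true) (sym o≡b) ab
    ... | ab , _ | inj₂ (refl , o≡a , _) = subst (λ z → adj v z ≡ true) (sym o≡a) (adj-sym ab)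

    other-injective : ∀ d d' → touching d ≡ true → touching d' ≡ true → other d ≡ other d' → d ≡ d'
    other-injective (a , b) (a' , b') t t' e with touching-shape a b t | touching-shape a' b' t'
    ... | inj₁ (a≡v , o≡b , _) | inj₁ (a'≡v , o'≡b' , _) = cong₂ _,_ (trans a≡v (sym a'≡v)) (trans (sym o≡b) (trans e o'≡b'))
    ... | inj₁ (_ , o≡b , v<b) | inj₂ (_ , o'≡a' , a'<v) =
          ⊥-elim (<ᶠ-asym v b v<b (subst (λ z → z <ᶠ v ≡ true) (trans (sym o'≡a') (trans (sym e) o≡b)) a'<v))
    ... | inj₂ (_ , o≡a , a<v) | inj₁ (_ , o'≡b' , v<b') =
          ⊥-elim (<ᶠ-asym v b' v<b' (subst (λ z → z <ᶠ v ≡ true) (trans (sym o≡a) (trans e o'≡b')) a<v))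
    ... | inj₂ (b≡v , o≡a , _) | inj₂ (b'≡v , o'≡a' , _) = cong₂ _,_ (trans (sym o≡a) (trans e o'≡a')) (trans b≡v (sym b'≡v))

  touching-edges≡deg : countᵖ touching ≡ deg G v
  touching-edges≡deg = ≤-antisym
    (injection⇒card≤card (pairCounting n) (finCounting n) touching (adj v) other touching-other other-injective)
    (injection⇒card≤card (finCounting n) (pairCounting n) (adj v) touching ordered ordered-touching ordered-injective)

  numEdges-deletion : numEdges G ≡ numEdges H + deg G v
  numEdges-deletion = begin
      numEdges G                                                   ≡⟨ countᵖ-split (edge adj) touches-v ⟩
      countᵖ touching + countᵖ (λ d → edge adj d ∧ not (touches-v d)) ≡⟨ cong₂ _+_ touching-edges≡deg (countᵖ-cong _ _ (λ d → sym (edgeH≡edge∖touches d))) ⟩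
      deg G v + numEdges H                                         ≡⟨ +-comm (deg G v) _ ⟩
      numEdges H + deg G v                                         ∎
    where open ≡-Reasoning

module _ (G : Graph) (R : Rotation G) (v : Fin (Graph.n G)) where
  open Graph G using (n)
  open EdgeDeletion G R v

  colouring-extends : (∀ x y → ¬ x ≡ v → ¬ y ≡ v → Dist≤2 G x y → Dist≤2 H x y) →
                      (near : Fin 19 → Fin n) → (∀ y → Dist≤2 G v y → ∃[ s ] y ≡ near s) →
                      χ₂≤ H 20 → χ₂≤ G 20
  colouring-extends transfer near covers (j , j≤20 , c , c-ok) = 20 , ≤-refl , col , λ x y → col-ok′ x y (x ≟ᶠ v) (y ≟ᶠ v)
    where
      colH : Fin n → Fin 20
      colH x = inject≤ (c x) j≤20
      colH-ok : ∀ x y → Dist≤2 H x y → ¬ colH x ≡ colH y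
      colH-ok x y d e = c-ok x y d (inject≤-injective j≤20 j≤20 (c x) (c y) e)
      free : ∃[ c ] (∀ s → ¬ colH (near s) ≡ c)
      free = missing-colour (λ s → colH (near s))
      col : Fin n → Fin 20
      col x = if x == v then proj₁ free else colH x
      v-ok : ∀ y → Dist≤2 G v y → ¬ proj₁ free ≡ colH y
      v-ok y d e = let (s , y≡) = covers y d in proj₂ free s (trans (cong colH (sym y≡)) (sym e))
      col-v : col v ≡ proj₁ free
      col-v = cong (λ b → if b then proj₁ free else colH v) (==-refl v)
      col-away : ∀ x → ¬ x ≡ v → col x ≡ colH x
      col-away x x≢v = cong (λ b → if b then proj₁ free else colH x) (≢⇒==false x≢v)
      col-ok′ : ∀ x y → Dec (x ≡ v) → Dec (y ≡ v) → Dist≤2 G x y → ¬ col x ≡ col y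
      col-ok′ x y (yes x≡v) (yes y≡v) d = ⊥-elim (proj₁ d (trans x≡v (sym y≡v)))
      col-ok′ x y (yes refl) (no y≢v) d e = v-ok y d (trans (sym col-v) (trans e (col-away y y≢v)))
      col-ok′ x y (no x≢v) (yes refl) d e = v-ok x (Dist≤2-sym G x v d) (trans (sym col-v) (trans (sym e) (col-away x x≢v)))
      col-ok′ x y (no x≢v) (no y≢v) d e = colH-ok x y (transfer x y x≢v y≢v d) (trans (sym (col-away x x≢v)) (trans e (col-away y y≢v)))

-- U i is the i-th neighbour of v in rotation order, and the face of the dart
-- (v , U (suc i)) is the triangle v, U (suc i), U i.
record Wheel (G : Graph) (R : Rotation G) (v : Fin (Graph.n G)) : Set where
  open Graph G using (n; adj)
  open Rotation R
  field
    U             : ℕ → Fin n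
    U-adj         : ∀ i → adj v (U i) ≡ true
    U-rot         : ∀ i → rot v (U i) ≡ U (suc i)
    U-5+          : ∀ i → U (5 + i) ≡ U i
    U-onto        : ∀ y → adj v y ≡ true → Σ ℕ λ j → j < 5 × y ≡ U j
    U-injective   : ∀ i j → i < 5 → j < 5 → U i ≡ U j → i ≡ j
    rot-U-centre  : ∀ i → rot (U (suc i)) v ≡ U i
    rot-U-U       : ∀ i → rot (U i) (U (suc i)) ≡ v
    rim-adj       : ∀ i → adj (U i) (U (suc i)) ≡ true

module _ (G : Graph) (R : Rotation G) (v : Fin (Graph.n G))
         (deg5 : deg G v ≡ 5) (triangles5 : Faces.facesOfDegAt G R 3 v ≡ 5) where
  open Graph G using (n; adj)
  open Rotation R
  open Faces G R
  open RotationProperties G R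

  private
    all-darts-triangular : ∀ x → adj v x ≡ true → faceDeg (v , x) ≡ 3
    all-darts-triangular x vx = ≡ᵇ⇒≡ _ _ (subst T (sym Qx) _)
      where
        Q : Fin n → Bool
        Q y = adj v y ∧ (faceDeg (v , y) ≡ᵇ 3)
        Q⊆adj : ∀ y → Q y ≡ true → adj v y ≡ true
        Q⊆adj y t = proj₁ (∧-elim {adj v y} t)
        all : count Q ≡ count (adj v)
        all = trans (≤-antisym (subst (count Q ≤_) deg5 (#Fin.card-mono Q (adj v) Q⊆adj))
                               (subst (_≤ count Q) triangles5 (facesOfDegAt≤ 3 v)))
                    (sym deg5)
        Qx : (faceDeg (v , x) ≡ᵇ 3) ≡ true
        Qx = proj₂ (∧-elim {adj v x} (#Fin.⊆-card-≡⇒⊇ Q (adj v) Q⊆adj all x vx))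

    u₀ : Fin n
    u₀ = proj₁ (count-witness (adj v) (λ e → 0≢1+n (trans (sym e) deg5)))
    vu₀ : adj v u₀ ≡ true
    vu₀ = proj₂ (count-witness (adj v) (λ e → 0≢1+n (trans (sym e) deg5)))

    Pv : Period (rot v) u₀
    Pv = rot-period v u₀ vu₀
    p≡5 : Period.p Pv ≡ 5
    p≡5 = trans (sym (deg≡period v u₀ vu₀)) deg5

    U : ℕ → Fin n
    U i = iter (rot v) i u₀

    U-adj : ∀ i → adj v (U i) ≡ true
    U-adj = adj-iter-rot v u₀ vu₀

    U-5+ : ∀ i → U (5 + i) ≡ U i
    U-5+ i = trans (cong (λ k → iter (rot v) k u₀) (+-comm 5 i))
                   (trans (iter-+ (rot v) i 5 u₀) (cong (iter (rot v) i) (subst (λ k → iter (rot v) k u₀ ≡ u₀) p≡5 (Period.iter-p Pv))))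

    rim-triangle : ∀ i → rot (U (suc i)) v ≡ U i × rot (U i) (U (suc i)) ≡ v × adj (U i) (U (suc i)) ≡ true
    rim-triangle i = a≡Uᵢ , subst (λ z → rot z x ≡ v) a≡Uᵢ (proj₁ t) , subst (λ z → adj z x ≡ true) a≡Uᵢ ax
      where
        x : Fin n
        x = U (suc i)
        t : rot (rot x v) x ≡ v × rot v (rot x v) ≡ x × adj v (rot x v) ≡ true
        t = triangle-rot v x (U-adj (suc i)) (triangle-φ³ (v , x) (U-adj (suc i)) (all-darts-triangular x (U-adj (suc i))))
        a : Fin n
        a = rot x v
        a≡Uᵢ : a ≡ U i
        a≡Uᵢ = rot-injective v a (U i) (proj₂ (proj₂ t)) (U-adj i) (proj₁ (proj₂ t))
        ax : adj a x ≡ true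
        ax = adj-sym (rot-adj x v (adj-sym (U-adj (suc i))))

  abstract
    wheel : Wheel G R v
    wheel = record
      { U = U ; U-adj = U-adj ; U-rot = λ i → refl ; U-5+ = U-5+
      ; U-onto = λ y a → let (k , k<p , e) = neighbour-index v u₀ vu₀ y a in k , subst (k <_) p≡5 k<p , e
      ; U-injective = λ i j i<5 j<5 → PeriodProperties.distinct Pv i j (subst (i <_) (sym p≡5) i<5) (subst (j <_) (sym p≡5) j<5)
      ; rot-U-centre = λ i → proj₁ (rim-triangle i)
      ; rot-U-U = λ i → proj₁ (proj₂ (rim-triangle i))
      ; rim-adj = λ i → proj₂ (proj₂ (rim-triangle i)) }

module WheelProperties (G : Graph) (R : Rotation G) (v : Fin (Graph.n G)) (W : Wheel G R v) where
  open Graph G using (n; adj; irrefl)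
  open Rotation R
  open Wheel W
  open RotationProperties G R using (rot-injective)

  U≢v : ∀ i → ¬ U i ≡ v
  U≢v i e = true⇒¬false (subst (λ z → adj v z ≡ true) e (U-adj i)) (irrefl v)

  U-cancel : ∀ i a b → U (a + i) ≡ U (b + i) → U a ≡ U b
  U-cancel zero a b e = subst₂ (λ x y → U x ≡ U y) (+-identityʳ a) (+-identityʳ b) e
  U-cancel (suc i) a b e = U-cancel i a b (rot-injective v _ _ (U-adj (a + i)) (U-adj (b + i)) (begin
      rot v (U (a + i))  ≡⟨ U-rot (a + i) ⟩
      U (suc (a + i))    ≡⟨ cong U (+-suc a i) ⟨
      U (a + suc i)      ≡⟨ e ⟩
      U (b + suc i)      ≡⟨ cong U (+-suc b i) ⟩
      U (suc (b + i))    ≡⟨ U-rot (b + i) ⟨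
      rot v (U (b + i))  ∎))
    where open ≡-Reasoning

  U-shift-injective : ∀ i a b → a < 5 → b < 5 → U (a + i) ≡ U (b + i) → a ≡ b
  U-shift-injective i a b a<5 b<5 e = U-injective a b a<5 b<5 (U-cancel i a b e)

-- Deleting the five spokes changes E by -5, F by -4, I by +1 and C by +1.
euler-shift : ∀ V A I E c → V + (5 + A) + I ≡ (E + 5) + 2 * c → V + (1 + A) + suc I ≡ E + 2 * suc c
euler-shift V A I E c h = +-cancelʳ-≡ 3 _ _ (begin
    V + (1 + A) + suc I + 3   ≡⟨ lhs V A I ⟩
    V + (5 + A) + I           ≡⟨ h ⟩
    E + 5 + 2 * c             ≡⟨ rhs E c ⟩
    E + 2 * suc c + 3         ∎)
  where
    open ≡-Reasoning
    lhs : ∀ V A I → V + (1 + A) + suc I + 3 ≡ V + (5 + A) + I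
    lhs = solve-∀
    rhs : ∀ E c → E + 5 + 2 * c ≡ E + 2 * suc c + 3
    rhs = solve-∀

module WheelDeletion (G : Graph) (R : Rotation G) (v : Fin (Graph.n G)) (W : Wheel G R v) where
  open Graph G using (n; adj; irrefl)
  open Rotation R
  open Wheel W
  open RotationProperties G R
  open EdgeDeletion G R v
  open WheelProperties G R v W
  private
    module RG = Reachability G
    module RH = Reachability H

  rimH : ∀ i → adjH (U i) (U (suc i)) ≡ true
  rimH i = adj⇒adjH (rim-adj i) (U≢v i) (U≢v (suc i))

  rim-walk : ∀ i m → reach H m (U i) (U (m + i)) ≡ true
  rim-walk i zero = RH.reach-refl 0 (U i)
  rim-walk i (suc m) = RH.reach-step m (U i) (U (m + i)) (U (suc m + i)) (rim-walk i m) (rimH (m + i))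

  neighbour-reaches-U₀ : ∀ z → adj v z ≡ true → ∃[ K ] reach H K z (U 0) ≡ true
  neighbour-reaches-U₀ z vz with U-onto z vz
  ... | j , j<5 , refl = 5 ∸ j , subst (λ u → reach H (5 ∸ j) (U j) u ≡ true)
                                       (trans (cong U (m∸n+n≡m (<⇒≤ j<5))) (U-5+ 0)) (rim-walk j (5 ∸ j))

  U₀-reaches-neighbour : ∀ z → adj v z ≡ true → ∃[ K ] reach H K (U 0) z ≡ true
  U₀-reaches-neighbour z vz with U-onto z vz
  ... | j , _ , refl = j , subst (λ i → reach H j (U 0) (U i) ≡ true) (+-identityʳ j) (rim-walk 0 j)

  reachG⇒reachH-walk : ∀ x → ¬ x ≡ v → ∀ k y → reach G k x y ≡ true →
                       (¬ y ≡ v → ∃[ K ] reach H K x y ≡ true) × (y ≡ v → ∃[ K ] reach H K x (U 0) ≡ true)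
  reachG⇒reachH-walk x x≢v zero y r with ==⇒≡ {a = x} {y} r
  ... | refl = (λ _ → 0 , RH.reach-refl 0 x) , (λ x≡v → ⊥-elim (x≢v x≡v))
  reachG⇒reachH-walk x x≢v (suc k) y r with RG.reach-unstep k x y r
  ... | inj₁ r' = reachG⇒reachH-walk x x≢v k y r'
  ... | inj₂ (z , rz , zy) with reachG⇒reachH-walk x x≢v k z rz | z == v in z≈v
  ... | (to-z , _) | false = via-z , to-v
    where
      z≢v : ¬ z ≡ v
      z≢v = ==false⇒≢ z≈v
      via-z : ¬ y ≡ v → ∃[ K ] reach H K x y ≡ true
      via-z y≢v = let (K , rK) = to-z z≢v in suc K , RH.reach-step K x z y rK (adj⇒adjH zy z≢v y≢v)
      to-v : y ≡ v → ∃[ K ] reach H K x (U 0) ≡ true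
      to-v refl = let (K , rK) = to-z z≢v ; (K' , rK') = neighbour-reaches-U₀ z (adj-sym zy) in
                  K' + K , RH.reach-trans K K' x z (U 0) rK rK'
  ... | (_ , to-U₀) | true with ==⇒≡ z≈v
  ... | refl = via-rim , (λ y≡v → ⊥-elim (true⇒¬false (subst (λ w → adj v w ≡ true) y≡v zy) (irrefl v)))
    where
      via-rim : ¬ y ≡ v → ∃[ K ] reach H K x y ≡ true
      via-rim _ = let (K , rK) = to-U₀ refl ; (K' , rK') = U₀-reaches-neighbour y zy in
                  K' + K , RH.reach-trans K K' x (U 0) y rK rK'

  reachG⇒reachH : ∀ x y → ¬ x ≡ v → ¬ y ≡ v → reach G n x y ≡ true → reach H n x y ≡ true
  reachG⇒reachH x y x≢v y≢v r = let (K , rK) = proj₁ (reachG⇒reachH-walk x x≢v n y r) y≢v in RH.reach-stabilises K x y rK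

  isolated-deletion : numIsolated H ≡ suc (numIsolated G)
  isolated-deletion = #Fin.card-insert (λ x → deg G x ≡ᵇ 0) (λ x → deg H x ≡ᵇ 0) v
      (isIsolated-adj G v (U 0) (U-adj 0)) (cong (_≡ᵇ 0) degH-v) (λ x x≢v → sym (same x x≢v))
    where
      same : ∀ x → ¬ x ≡ v → (deg H x ≡ᵇ 0) ≡ (deg G x ≡ᵇ 0)
      same x x≢v with adj x v in xv
      ... | false = cong (_≡ᵇ 0) (degH-away x xv x≢v)
      ... | true with U-onto x (adj-sym xv)
      ... | j , _ , refl = trans (isIsolated-adj H (U j) (U (suc j)) (rimH j)) (sym (isIsolated-adj G (U j) v xv))

  reachH-from-v : ∀ y → reach H n v y ≡ true → v ≡ y
  reachH-from-v y r = RH.reach-isolated n v y v-isolatedH r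

  v-leaderH : RH.isLeader v ≡ true
  v-leaderH = RH.≤⇒isLeader v λ w r → ≤-reflexive (cong toℕ (reachH-from-v w r))

  leaderG⇒leaderH : ∀ x → RG.isLeader x ≡ true → RH.isLeader x ≡ true
  leaderG⇒leaderH x h = RH.≤⇒isLeader x λ w r → RG.isLeader⇒≤ x h w (reachH⇒reachG n x w r)

  leaderH⇒leaderG : ∀ x → ¬ x ≡ v →
                    (reach G n x v ≡ true → Σ (Fin n) λ w → ¬ w ≡ v × reach G n x w ≡ true × toℕ w ≤ toℕ v) →
                    RH.isLeader x ≡ true → RG.isLeader x ≡ true
  leaderH⇒leaderG x x≢v detour h = RG.≤⇒isLeader x below
    where
      below : ∀ w → reach G n x w ≡ true → toℕ x ≤ toℕ w
      below w r with w == v in w≈v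
      ... | false = RH.isLeader⇒≤ x h w (reachG⇒reachH x w x≢v (==false⇒≢ w≈v) r)
      ... | true with ==⇒≡ w≈v
      ... | refl = let (w' , w'≢v , rw' , w'≤v) = detour r in
                   ≤-trans (RH.isLeader⇒≤ x h w' (reachG⇒reachH x w' x≢v w'≢v rw')) w'≤v

  v-reaches-U₀ : reach G n v (U 0) ≡ true
  v-reaches-U₀ = RG.reach-stabilises 1 v (U 0) (RG.reach-step 0 v v (U 0) (RG.reach-refl 0 v) (U-adj 0))

  components-v-not-leader : RG.isLeader v ≡ false → numComponents H ≡ suc (numComponents G)
  components-v-not-leader ¬lv with RG.¬isLeader⇒smaller v ¬lv
  ... | w' , v⇝w' , w'<v = #Fin.card-insert RG.isLeader RH.isLeader v ¬lv v-leaderH same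
    where
      same : ∀ x → ¬ x ≡ v → RG.isLeader x ≡ RH.isLeader x
      same x x≢v = true-ext (leaderG⇒leaderH x) (leaderH⇒leaderG x x≢v λ x⇝v →
        w' , (λ e → <-irrefl (cong toℕ e) w'<v) , RG.reach-trans-n x v w' x⇝v v⇝w' , <⇒≤ w'<v)

  components-v-leader : RG.isLeader v ≡ true → numComponents H ≡ suc (numComponents G)
  components-v-leader lv = #Fin.card-insert RG.isLeader RH.isLeader m ¬leaderG-m leaderH-m same
    where
      rest : Fin n → Bool
      rest y = not (y == v) ∧ reach G n v y
      least : Σ (Fin n) λ m → rest m ≡ true × (∀ x → rest x ≡ true → toℕ m ≤ toℕ x)
      least = least-vertex rest (U 0) (∧-intro (false⇒not-true (≢⇒==false (U≢v 0))) v-reaches-U₀)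
      m : Fin n
      m = proj₁ least
      m≢v : ¬ m ≡ v
      m≢v = ==false⇒≢ (not-true⇒false (proj₁ (∧-elim {not (m == v)} (proj₁ (proj₂ least)))))
      v⇝m : reach G n v m ≡ true
      v⇝m = proj₂ (∧-elim {not (m == v)} (proj₁ (proj₂ least)))
      m≤ : ∀ x → ¬ x ≡ v → reach G n v x ≡ true → toℕ m ≤ toℕ x
      m≤ x x≢v r = proj₂ (proj₂ least) x (∧-intro (false⇒not-true (≢⇒==false x≢v)) r)
      leaderH-m : RH.isLeader m ≡ true
      leaderH-m = RH.≤⇒isLeader m λ w r →
        m≤ w (λ { refl → m≢v (sym (reachH-from-v m (RH.reach-sym n m v r))) }) (RG.reach-trans-n v m w v⇝m (reachH⇒reachG n m w r))
      ¬leaderG-m : RG.isLeader m ≡ false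
      ¬leaderG-m = ¬true⇒false λ lm → m≢v (RG.leader-unique m v lm (RG.reach-sym n v m v⇝m) (RG.isLeader⇒≤ v lv m v⇝m))
      same : ∀ x → ¬ x ≡ m → RG.isLeader x ≡ RH.isLeader x
      same x x≢m with x == v in x≈v
      ... | true rewrite ==⇒≡ x≈v = trans lv (sym v-leaderH)
      ... | false with reach G n x v in x⇝v
      ... | true = trans (¬true⇒false λ lx → x≢v (RG.leader-unique x v lx x⇝v (RG.isLeader⇒≤ v lv x v⇝x)))
                         (sym (¬true⇒false λ lx → x≢m (RH.leader-unique x m lx x⇝ᴴm (m≤ x x≢v v⇝x))))
        where
          x≢v : ¬ x ≡ v
          x≢v = ==false⇒≢ x≈v
          v⇝x : reach G n v x ≡ true
          v⇝x = RG.reach-sym n x v x⇝v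
          x⇝ᴴm : reach H n x m ≡ true
          x⇝ᴴm = reachG⇒reachH x m x≢v m≢v (RG.reach-trans-n x v m x⇝v v⇝m)
      ... | false = true-ext (leaderG⇒leaderH x) (leaderH⇒leaderG x (==false⇒≢ x≈v) λ r → ⊥-elim (true⇒¬false r x⇝v))

  -- Components are counted by their least vertices.  If v was the least vertex
  -- of its component, the least of the remaining ones becomes a new leader;
  -- otherwise v itself is the new leader.
  components-deletion : numComponents H ≡ suc (numComponents G)
  components-deletion with RG.isLeader v in lv
  ... | true = components-v-leader lv
  ... | false = components-v-not-leader lv

  open Faces G R
  private
    module RPH = RotationProperties H RH
    module FH = Faces H RH

  isRimDart : Pair n → Bool
  isRimDart (a , b) = adj v a ∧ adj v b ∧ (rot v b == a)

  isWheelDart : Pair n → Bool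
  isWheelDart (a , b) = (a == v) ∨ (b == v) ∨ isRimDart (a , b)

  spoke rim spoke⁻ : ℕ → Pair n
  spoke i = (v , U (suc i))
  rim i = (U (suc i) , U i)
  spoke⁻ i = (U i , v)

  InTriangle : ℕ → Pair n → Set
  InTriangle i d = d ≡ spoke i ⊎ d ≡ rim i ⊎ d ≡ spoke⁻ i

  InTriangle-φ : ∀ i d → InTriangle i d → InTriangle i (φ d)
  InTriangle-φ i d (inj₁ refl) = inj₂ (inj₁ (cong (U (suc i) ,_) (rot-U-centre i)))
  InTriangle-φ i d (inj₂ (inj₁ refl)) = inj₂ (inj₂ (cong (U i ,_) (rot-U-U i)))
  InTriangle-φ i d (inj₂ (inj₂ refl)) = inj₁ (cong (v ,_) (U-rot i))

  inFace⇒InTriangle : ∀ i d → inFace (spoke i) d ≡ true → InTriangle i d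
  inFace⇒InTriangle i d h with inFace⇒iter (spoke i) d h
  ... | k , refl = go k
    where
      go : ∀ k → InTriangle i (iter φ k (spoke i))
      go zero = inj₁ refl
      go (suc k) = InTriangle-φ i _ (go k)

  InTriangle⇒inFace : ∀ i d → InTriangle i d → inFace (spoke i) d ≡ true
  InTriangle⇒inFace i d t = iter⇒inFace (spoke i) d (U-adj (suc i)) (steps t) (reach-d t)
    where
      steps : InTriangle i d → ℕ
      steps (inj₁ _) = 0
      steps (inj₂ (inj₁ _)) = 1
      steps (inj₂ (inj₂ _)) = 2
      reach-d : (t : InTriangle i d) → iter φ (steps t) (spoke i) ≡ d
      reach-d (inj₁ refl) = refl
      reach-d (inj₂ (inj₁ refl)) = cong (U (suc i) ,_) (rot-U-centre i)
      reach-d (inj₂ (inj₂ refl)) = trans (cong φ (cong (U (suc i) ,_) (rot-U-centre i))) (cong (U i ,_) (rot-U-U i))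

  rim-isRimDart : ∀ i → isRimDart (rim i) ≡ true
  rim-isRimDart i = ∧-intro (U-adj (suc i)) (∧-intro (U-adj i) (subst (λ z → (z == U (suc i)) ≡ true) (sym (U-rot i)) (==-refl _)))

  InTriangle⇒wheel : ∀ i d → InTriangle i d → isWheelDart d ≡ true
  InTriangle⇒wheel i d (inj₁ refl) = ∨-introˡ (==-refl v)
  InTriangle⇒wheel i d (inj₂ (inj₁ refl)) = ∨-introʳ {U (suc i) == v} (∨-introʳ {U i == v} (rim-isRimDart i))
  InTriangle⇒wheel i d (inj₂ (inj₂ refl)) = ∨-introʳ {U i == v} (∨-introˡ (==-refl v))

  isRimDart⇒rim : ∀ a b → isRimDart (a , b) ≡ true → Σ ℕ λ j → j < 5 × (a , b) ≡ rim j
  isRimDart⇒rim a b r with ∧₃-elim {adj v a} r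
  ... | _ , vb , rot-b≈a with U-onto b vb
  ... | j , j<5 , refl = j , j<5 , cong (_, U j) (sym (trans (sym (U-rot j)) (==⇒≡ rot-b≈a)))

  pred<5 : ∀ {i} → suc i < 5 → i < 5
  pred<5 (s≤s i<4) = ≤-trans i<4 (n≤1+n 4)

  wheel⇒InTriangle : ∀ d → isDart d ≡ true → isWheelDart d ≡ true → Σ ℕ λ i → i < 5 × InTriangle i d
  wheel⇒InTriangle (a , b) ab w with ∨-elim {a == v} w
  ... | inj₁ a≈v rewrite ==⇒≡ a≈v with U-onto b ab
  ... | zero , _ , refl = 4 , ≤-refl , inj₁ (cong (v ,_) (sym (U-5+ 0)))
  ... | suc i , i+1<5 , refl = i , pred<5 i+1<5 , inj₁ refl
  wheel⇒InTriangle (a , b) ab w | inj₂ w' with ∨-elim {b == v} w'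
  ... | inj₁ b≈v rewrite ==⇒≡ b≈v with U-onto a (adj-sym ab)
  ... | j , j<5 , refl = j , j<5 , inj₂ (inj₂ refl)
  wheel⇒InTriangle (a , b) ab w | inj₂ w' | inj₂ r with isRimDart⇒rim a b r
  ... | j , j<5 , e = j , j<5 , inj₂ (inj₁ e)

  spoke-in-triangle : ∀ i j → i < 5 → j < 5 → InTriangle i (spoke j) → i ≡ j
  spoke-in-triangle i j i<5 j<5 (inj₁ e) =
    sym (U-injective j i j<5 i<5 (rot-injective v (U j) (U i) (U-adj j) (U-adj i) (trans (U-rot j) (trans (cong proj₂ e) (sym (U-rot i))))))
  spoke-in-triangle i j _ _ (inj₂ (inj₁ e)) = ⊥-elim (U≢v (suc i) (sym (cong proj₁ e)))
  spoke-in-triangle i j _ _ (inj₂ (inj₂ e)) = ⊥-elim (U≢v i (sym (cong proj₁ e)))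

  wheel-faces-G : countᵖ (λ d → isRep d ∧ isWheelDart d) ≡ 5
  wheel-faces-G = faces-enumerated isWheelDart 5 (λ i → spoke (toℕ i)) (λ i → U-adj (suc (toℕ i)))
    (λ d dd w → let (i , i<5 , t) = wheel⇒InTriangle d dd w in
                fromℕ< i<5 , subst (λ k → inFace (spoke k) d ≡ true) (sym (toℕ-fromℕ< i<5)) (InTriangle⇒inFace i d t))
    (λ i d h → InTriangle⇒wheel (toℕ i) d (inFace⇒InTriangle (toℕ i) d h))
    (λ i j h → toℕ-injective (spoke-in-triangle (toℕ i) (toℕ j) (toℕ<n i) (toℕ<n j) (inFace⇒InTriangle (toℕ i) _ h)))

  rim-isDartH : ∀ i → RPH.isDart (rim i) ≡ true
  rim-isDartH i = adj⇒adjH (adj-sym (rim-adj i)) (U≢v (suc i)) (U≢v i)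

  φH-rim : ∀ i → FH.φ (rim (suc i)) ≡ rim i
  φH-rim i = cong (U (suc i) ,_) (trans (rotH-≡ (U (suc i)) (U (suc (suc i))) (rot-U-U (suc i))) (rot-U-centre i))

  rim-5 : rim 5 ≡ rim 0
  rim-5 = cong₂ _,_ (U-5+ 1) (U-5+ 0)

  OnRim : Pair n → Set
  OnRim d = Σ ℕ λ i → i < 5 × d ≡ rim i

  OnRim-φH : ∀ d → OnRim d → OnRim (FH.φ d)
  OnRim-φH d (zero , _ , refl) = 4 , ≤-refl , trans (cong FH.φ (sym rim-5)) (φH-rim 4)
  OnRim-φH d (suc i , i+1<5 , refl) = i , pred<5 i+1<5 , φH-rim i

  rim-descends : ∀ m j → iter FH.φ m (rim (m + j)) ≡ rim j
  rim-descends zero j = refl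
  rim-descends (suc m) j = trans (iter-sucʳ FH.φ m (rim (suc m + j))) (trans (cong (iter FH.φ m) (φH-rim (m + j))) (rim-descends m j))

  pentagon : ∀ i → i < 5 → FH.inFace (rim 0) (rim i) ≡ true
  pentagon i i<5 = RPH.iter⇒inFace (rim 0) (rim i) (rim-isDartH 0) (5 ∸ i)
    (trans (cong (iter FH.φ (5 ∸ i)) (trans (sym rim-5) (cong rim (sym (m∸n+n≡m (<⇒≤ i<5)))))) (rim-descends (5 ∸ i) i))

  wheelH⇒OnRim : ∀ d → RPH.isDart d ≡ true → isWheelDart d ≡ true → OnRim d
  wheelH⇒OnRim (a , b) ab w with adjH⇒adj {a} {b} ab
  ... | _ , a≢v , b≢v with ∨₃-elim {a == v} w
  ... | inj₁ a≈v = ⊥-elim (a≢v (==⇒≡ a≈v))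
  ... | inj₂ (inj₁ b≈v) = ⊥-elim (b≢v (==⇒≡ b≈v))
  ... | inj₂ (inj₂ r) = isRimDart⇒rim a b r

  wheel-faces-H : countᵖ (λ d → FH.isRep d ∧ isWheelDart d) ≡ 1
  wheel-faces-H = RPH.faces-enumerated isWheelDart 1 (λ _ → rim 0) (λ _ → rim-isDartH 0)
    (λ d dd w → let (i , i<5 , e) = wheelH⇒OnRim d dd w in fz , subst (λ z → FH.inFace (rim 0) z ≡ true) (sym e) (pentagon i i<5))
    (λ { fz d h → let (k , eₖ) = RPH.inFace⇒iter (rim 0) d h ; (i , _ , e) = subst OnRim eₖ (on-rim k) in
                  subst (λ z → isWheelDart z ≡ true) (sym e) (InTriangle⇒wheel i (rim i) (inj₂ (inj₁ refl))) })
    (λ { fz fz _ → refl })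
    where
      on-rim : ∀ k → OnRim (iter FH.φ k (rim 0))
      on-rim zero = 0 , s≤s z≤n , refl
      on-rim (suc k) = OnRim-φH _ (on-rim k)

  module OffWheel (a b : Fin n) (ab : adj a b ≡ true) (off : isWheelDart (a , b) ≡ false) where
    parts : (a == v) ≡ false × (b == v) ≡ false × isRimDart (a , b) ≡ false
    parts = ∨₃-false {a == v} {b == v} {isRimDart (a , b)} off
    a≢v : ¬ a ≡ v
    a≢v = ==false⇒≢ (proj₁ parts)
    b≢v : ¬ b ≡ v
    b≢v = ==false⇒≢ (proj₁ (proj₂ parts))

    c : Fin n
    c = rot b a
    ba : adj b a ≡ true
    ba = adj-sym ab

    c≢v : ¬ c ≡ v
    c≢v c≡v with U-onto b (adj-sym (subst (λ z → adj b z ≡ true) c≡v (rot-adj b a ba)))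
    ... | j , _ , refl = true⇒¬false (subst (λ z → isRimDart (z , U j) ≡ true) (sym a≡) (rim-isRimDart j))
                                     (proj₂ (proj₂ parts))
      where
        a≡ : a ≡ U (suc j)
        a≡ = rot-injective (U j) a (U (suc j)) ba (rim-adj j) (trans c≡v (sym (rot-U-U j)))

    φ-not-rim : isRimDart (b , c) ≡ false
    φ-not-rim = ¬true⇒false λ r → let (_ , vc , rot-c≈b) = ∧₃-elim {adj v b} r in after-rim vc (==⇒≡ rot-c≈b)
      where
        after-rim : adj v c ≡ true → rot v c ≡ b → ⊥
        after-rim vc rot-c≡b with U-onto c vc
        ... | m , _ , c≡Uₘ = a≢v (sym (rot-injective b v a (subst (λ z → adj z v ≡ true) Uₘ₊₁≡b (adj-sym (U-adj (suc m)))) ba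
                  (trans (cong (λ z → rot z v) (sym Uₘ₊₁≡b)) (trans (rot-U-centre m) (sym c≡Uₘ)))))
          where
            Uₘ₊₁≡b : U (suc m) ≡ b
            Uₘ₊₁≡b = trans (sym (U-rot m)) (trans (cong (rot v) (sym c≡Uₘ)) rot-c≡b)

    φ-off-wheel : isWheelDart (φ (a , b)) ≡ false × FH.φ (a , b) ≡ φ (a , b)
    φ-off-wheel = all-false (≢⇒==false b≢v) (≢⇒==false c≢v) φ-not-rim , cong (b ,_) (rotH-≢ b a c≢v)
      where
        all-false : ∀ {x y z} → x ≡ false → y ≡ false → z ≡ false → (x ∨ y ∨ z) ≡ false
        all-false refl refl refl = refl

    isDartH : RPH.isDart (a , b) ≡ isDart (a , b)
    isDartH = trans (adj⇒adjH ab a≢v b≢v) (sym ab)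

  iter-φ-off-wheel : ∀ d → isDart d ≡ true → isWheelDart d ≡ false →
                     ∀ k → iter FH.φ k d ≡ iter φ k d × isWheelDart (iter φ k d) ≡ false
  iter-φ-off-wheel d dd off zero = refl , off
  iter-φ-off-wheel d dd off (suc k) with iter-φ-off-wheel d dd off k
  ... | same , offₖ with iter φ k d | iter-φ-isDart k d dd
  ... | (a , b) | ab = let (off' , φH≡φ) = OffWheel.φ-off-wheel a b ab offₖ in trans (cong FH.φ same) φH≡φ , off'

  isRepH-off-wheel : ∀ d → isWheelDart d ≡ false → FH.isRep d ≡ isRep d
  isRepH-off-wheel (a , b) off = true-ext toG toH
    where
      d : Pair n
      d = (a , b)
      shared-faces : adj a b ≡ true → ∀ k → iter FH.φ k d ≡ iter φ k d
      shared-faces ab k = proj₁ (iter-φ-off-wheel d ab off k)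
      toG : FH.isRep d ≡ true → isRep d ≡ true
      toG r = let (ddH , least) = RPH.isRep⇒min d r ; ab = proj₁ (adjH⇒adj {a} {b} ddH) in
              min⇒isRep d ab λ x i → let (k , eₖ) = inFace⇒iter d x i in
              least x (RPH.iter⇒inFace d x ddH k (trans (shared-faces ab k) eₖ))
      toH : isRep d ≡ true → FH.isRep d ≡ true
      toH r = let (ab , least) = isRep⇒min d r ; ddH = trans (OffWheel.isDartH a b ab off) ab in
              RPH.min⇒isRep d ddH λ x i → let (k , eₖ) = RPH.inFace⇒iter d x i in
              least x (iter⇒inFace d x ab k (trans (sym (shared-faces ab k)) eₖ))

  off-wheel-faces : countᵖ (λ d → FH.isRep d ∧ not (isWheelDart d)) ≡ countᵖ (λ d → isRep d ∧ not (isWheelDart d))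
  off-wheel-faces = countᵖ-cong _ _ same
    where
      same : ∀ d → (FH.isRep d ∧ not (isWheelDart d)) ≡ (isRep d ∧ not (isWheelDart d))
      same d with isWheelDart d in w
      ... | true = trans (∧-zeroʳ (FH.isRep d)) (sym (∧-zeroʳ (isRep d)))
      ... | false = cong (_∧ true) (isRepH-off-wheel d w)

  deg-centre : deg G v ≡ 5
  deg-centre = ≤-antisym
    (#Fin.covered⇒card≤ 5 (λ i → U (toℕ i)) (adj v)
      λ y vy → let (j , j<5 , e) = U-onto y vy in fromℕ< j<5 , trans e (cong U (sym (toℕ-fromℕ< j<5))))
    (#Fin.injection⇒≤card 5 (λ i → U (toℕ i)) (λ i j e → toℕ-injective (U-injective _ _ (toℕ<n i) (toℕ<n j) e))
      (adj v) (λ i → U-adj (toℕ i)))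

  deletion-plane : IsPlane → FH.IsPlane
  deletion-plane plane = begin
      n + FH.numFaces + numIsolated H          ≡⟨ cong₂ (λ f i → n + f + i) facesH isolated-deletion ⟩
      n + (1 + A) + suc (numIsolated G)        ≡⟨ euler-shift n A (numIsolated G) (numEdges H) (numComponents G) eulerG ⟩
      numEdges H + 2 * suc (numComponents G)   ≡⟨ cong (λ c → numEdges H + 2 * c) components-deletion ⟨
      numEdges H + 2 * numComponents H         ∎
    where
      open ≡-Reasoning
      A : ℕ
      A = countᵖ (λ d → isRep d ∧ not (isWheelDart d))
      facesG : numFaces ≡ 5 + A
      facesG = trans (countᵖ-split isRep isWheelDart) (cong (_+ A) wheel-faces-G)
      facesH : FH.numFaces ≡ 1 + A
      facesH = trans (countᵖ-split FH.isRep isWheelDart) (cong₂ _+_ wheel-faces-H off-wheel-faces)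
      eulerG : n + (5 + A) + numIsolated G ≡ numEdges H + 5 + 2 * numComponents G
      eulerG = begin
          n + (5 + A) + numIsolated G               ≡⟨ cong (λ f → n + f + numIsolated G) facesG ⟨
          n + numFaces + numIsolated G              ≡⟨ plane ⟩
          numEdges G + 2 * numComponents G          ≡⟨ cong (λ e → e + 2 * numComponents G) (trans numEdges-deletion (cong (numEdges H +_) deg-centre)) ⟩
          numEdges H + 5 + 2 * numComponents G      ∎

  deletion-smaller : size H < size G
  deletion-smaller = subst (size H <_) (sym (cong (n +_) (trans numEdges-deletion (cong (numEdges H +_) deg-centre))))
                           (+-monoʳ-< n (m<m+n (numEdges H) (s≤s z≤n)))

  NearH : Fin n → Fin n → Set
  NearH x y = adjH x y ≡ true ⊎ Σ (Fin n) λ z → adjH x z ≡ true × adjH z y ≡ true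

  NearH-sym : ∀ x y → NearH x y → NearH y x
  NearH-sym x y (inj₁ xy) = inj₁ (trans (adjH-sym y x) xy)
  NearH-sym x y (inj₂ (z , xz , zy)) = inj₂ (z , trans (adjH-sym y z) zy , trans (adjH-sym z x) xz)

  rimH⁻ : ∀ i → adjH (U (5 + i)) (U (4 + i)) ≡ true
  rimH⁻ i = trans (adjH-sym (U (5 + i)) (U (4 + i))) (rimH (4 + i))

  rim-near-by : ∀ i d → 1 ≤ d → d ≤ 4 → NearH (U i) (U (d + i))
  rim-near-by i 1 _ _ = inj₁ (rimH i)
  rim-near-by i 2 _ _ = inj₂ (U (1 + i) , rimH i , rimH (1 + i))
  rim-near-by i 3 _ _ = inj₂ (U (4 + i) , subst (λ u → adjH u (U (4 + i)) ≡ true) (U-5+ i) (rimH⁻ i) ,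
                                          trans (adjH-sym (U (4 + i)) (U (3 + i))) (rimH (3 + i)))
  rim-near-by i 4 _ _ = inj₁ (subst (λ u → adjH u (U (4 + i)) ≡ true) (U-5+ i) (rimH⁻ i))
  rim-near-by i (suc (suc (suc (suc (suc _))))) _ (s≤s (s≤s (s≤s (s≤s ()))))

  rim-near : ∀ i j → i < 5 → j < 5 → ¬ i ≡ j → NearH (U i) (U j)
  rim-near i j i<5 j<5 i≢j with <-cmp i j
  ... | tri< i<j _ _ = forward i j i<j j<5
    where
      forward : ∀ i j → i < j → j < 5 → NearH (U i) (U j)
      forward i j i<j j<5 = subst (λ k → NearH (U i) (U k)) (m∸n+n≡m (<⇒≤ i<j))
        (rim-near-by i (j ∸ i) (m<n⇒0<n∸m i<j) (≤-trans (m∸n≤m j i) (≤-pred j<5)))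
  ... | tri≈ _ i≡j _ = ⊥-elim (i≢j i≡j)
  ... | tri> _ _ j<i = NearH-sym (U j) (U i) (subst (λ k → NearH (U j) (U k)) (m∸n+n≡m (<⇒≤ j<i))
        (rim-near-by j (i ∸ j) (m<n⇒0<n∸m j<i) (≤-trans (m∸n≤m i j) (≤-pred i<5))))

  dist≤2-deletion : ∀ x y → ¬ x ≡ v → ¬ y ≡ v → Dist≤2 G x y → Dist≤2 H x y
  dist≤2-deletion x y x≢v y≢v (x≢y , inj₁ xy) = x≢y , inj₁ (adj⇒adjH xy x≢v y≢v)
  dist≤2-deletion x y x≢v y≢v (x≢y , inj₂ (z , xz , zy)) with z == v in z≈v
  ... | false = x≢y , inj₂ (z , adj⇒adjH xz x≢v (==false⇒≢ z≈v) , adj⇒adjH zy (==false⇒≢ z≈v) y≢v)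
  ... | true with ==⇒≡ z≈v
  ... | refl with U-onto x (adj-sym xz) | U-onto y zy
  ... | i , i<5 , refl | j , j<5 , refl = x≢y , rim-near i j i<5 j<5 (λ i≡j → x≢y (cong U i≡j))

module _ (G : Graph) (mc : MinimalCounterexample G) (R : Rotation G) (plane : Faces.IsPlane G R)
         (v : Fin (Graph.n G)) (W : Wheel G R v) where
  open Graph G using (n)
  open EdgeDeletion G R v
  open WheelDeletion G R v W

  second-neighbourhood-injective : (f : Fin 20 → Fin n) → (∀ y → Dist≤2 G v y → ∃[ s ] y ≡ f s) →
                                   ∀ a b → f a ≡ f b → a ≡ b
  second-neighbourhood-injective f covers a b fa≡fb with a ≟ᶠ b
  ... | yes a≡b = a≡b
  ... | no a≢b = ⊥-elim (not-colourable (colouring-extends G R v dist≤2-deletion near near-covers colourableH))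
    where
      not-colourable : ¬ χ₂≤ G 20
      not-colourable = proj₁ (proj₂ (proj₂ mc))
      Δ≤6 : MaxDegreeAtMost G 6
      Δ≤6 = proj₁ (proj₂ mc)
      colourableH : χ₂≤ H 20
      colourableH = proj₂ (proj₂ (proj₂ mc)) H (RH , deletion-plane plane) (λ x → ≤-trans (degH≤deg x) (Δ≤6 x)) deletion-smaller
      near : Fin 19 → Fin n
      near = proj₁ (drop-repeat f a b a≢b fa≡fb)
      near-covers : ∀ y → Dist≤2 G v y → ∃[ t ] y ≡ near t
      near-covers y d = let (s , y≡) = covers y d ; (t , fs≡) = proj₂ (drop-repeat f a b a≢b fa≡fb) s in t , trans y≡ fs≡

-- Indices of the 20 vertices within distance two of v: the rim vertices and,
-- for each rim vertex U j, its neighbours E j 2, E j 3 and E j 4.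
Slot : Set
Slot = Fin 5 ⊎ Fin 5 × Fin 3

slot-index : Slot → Fin 20
slot-index (inj₁ j) = j ↑ˡ 15
slot-index (inj₂ (j , κ)) = 5 ↑ʳ combine j κ

index-slot : Fin 20 → Slot
index-slot s = map₂ (remQuot 3) (splitAt 5 s)

index-slot-index : ∀ σ → index-slot (slot-index σ) ≡ σ
index-slot-index (inj₁ j) rewrite splitAt-↑ˡ 5 j 15 = refl
index-slot-index (inj₂ (j , κ)) rewrite splitAt-↑ʳ 5 15 (combine j κ) | remQuot-combine {5} {3} j κ = refl

rim-of : Slot → Fin 5
rim-of (inj₁ j) = j
rim-of (inj₂ (j , _)) = j

module _ (G : Graph) (mc : MinimalCounterexample G) (R : Rotation G) (plane : Faces.IsPlane G R)
         (v : Fin (Graph.n G)) (deg5 : deg G v ≡ 5) (triangles5 : Faces.facesOfDegAt G R 3 v ≡ 5) where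
  open Graph G using (n; adj; irrefl)
  open Rotation R
  open Faces G R
  open RotationProperties G R
  open Wheel (wheel G R v deg5 triangles5)
  open WheelProperties G R v (wheel G R v deg5 triangles5)

  E : ℕ → ℕ → Fin n
  E m k = iter (rot (U m)) k v

  U-v : ∀ m → adj (U m) v ≡ true
  U-v m = adj-sym (U-adj m)

  p : ℕ → ℕ
  p m = Period.p (rot-period (U m) v (U-v m))

  deg≡p : ∀ m → deg G (U m) ≡ p m
  deg≡p m = deg≡period (U m) v (U-v m)

  p≤6 : ∀ m → p m ≤ 6
  p≤6 m = subst (_≤ 6) (deg≡p m) (proj₁ (proj₂ mc) (U m))

  E-adj : ∀ m k → adj (U m) (E m k) ≡ true
  E-adj m = adj-iter-rot (U m) v (U-v m)

  E-onto : ∀ m y → adj (U m) y ≡ true → Σ ℕ λ k → k < p m × y ≡ E m k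
  E-onto m = neighbour-index (U m) v (U-v m)

  E-1 : ∀ m → E m 1 ≡ U (4 + m)
  E-1 m = trans (cong (λ u → rot u v) (sym (U-5+ m))) (rot-U-centre (4 + m))

  E-last : ∀ m → E m (p m ∸ 1) ≡ U (suc m)
  E-last m with E-onto m (U (suc m)) (rim-adj m)
  ... | k , k<p , Uₘ₊₁≡Eₖ = trans (cong (E m) (cong (_∸ 1) (sym k+1≡p))) (sym Uₘ₊₁≡Eₖ)
    where
      k+1≡p : suc k ≡ p m
      k+1≡p = PeriodProperties.returns⇒last (rot-period (U m) v (U-v m)) k k<p
                (trans (cong (rot (U m)) (sym Uₘ₊₁≡Eₖ)) (rot-U-U m))

  beyond-6 : ∀ m k → 6 ≤ k → ¬ k < p m
  beyond-6 m k 6≤k k<p = <⇒≱ k<p (≤-trans (p≤6 m) 6≤k)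

  rim-neighbour : ∀ m y → adj (U m) y ≡ true →
                  y ≡ v ⊎ y ≡ U (4 + m) ⊎ y ≡ U (suc m) ⊎ Σ ℕ λ k → 2 ≤ k × k ≤ 4 × y ≡ E m k
  rim-neighbour m y my with E-onto m y my
  ... | 0 , _ , e = inj₁ e
  ... | 1 , _ , e = inj₂ (inj₁ (trans e (E-1 m)))
  ... | 2 , _ , e = inj₂ (inj₂ (inj₂ (2 , ≤-refl , s≤s (s≤s z≤n) , e)))
  ... | 3 , _ , e = inj₂ (inj₂ (inj₂ (3 , s≤s (s≤s z≤n) , s≤s (s≤s (s≤s z≤n)) , e)))
  ... | 4 , _ , e = inj₂ (inj₂ (inj₂ (4 , s≤s (s≤s z≤n) , ≤-refl , e)))
  ... | 5 , k<p , e = inj₂ (inj₂ (inj₁ (trans e (trans (cong (λ q → E m (q ∸ 1)) (≤-antisym k<p (p≤6 m))) (E-last m)))))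
  ... | suc (suc (suc (suc (suc (suc k))))) , k<p , _ = ⊥-elim (beyond-6 m _ (s≤s (s≤s (s≤s (s≤s (s≤s (s≤s z≤n)))))) k<p)

  slot : Slot → Fin n
  slot (inj₁ j) = U (toℕ j)
  slot (inj₂ (j , κ)) = E (toℕ j) (2 + toℕ κ)

  rim-index : ∀ m → Σ (Fin 5) λ j → U m ≡ U (toℕ j)
  rim-index m = let (j , j<5 , e) = U-onto (U m) (U-adj m) in fromℕ< j<5 , trans e (cong U (sym (toℕ-fromℕ< j<5)))

  outer-index : ∀ k → 2 ≤ k → k ≤ 4 → Σ (Fin 3) λ κ → k ≡ 2 + toℕ κ
  outer-index k 2≤k k≤4 = fromℕ< κ<3 , trans (sym (m+[n∸m]≡n 2≤k)) (cong (2 +_) (sym (toℕ-fromℕ< κ<3)))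
    where
      κ<3 : k ∸ 2 < 3
      κ<3 = s≤s (∸-monoˡ-≤ 2 k≤4)

  rimσ : ℕ → Slot
  rimσ m = inj₁ (proj₁ (rim-index m))

  outerσ : ∀ m k → 2 ≤ k → k ≤ 4 → Slot
  outerσ m k 2≤k k≤4 = inj₂ (proj₁ (rim-index m) , proj₁ (outer-index k 2≤k k≤4))

  rim-slot : ∀ m → U m ≡ slot (rimσ m)
  rim-slot m = proj₂ (rim-index m)

  outer-slot : ∀ m k (2≤k : 2 ≤ k) (k≤4 : k ≤ 4) → E m k ≡ slot (outerσ m k 2≤k k≤4)
  outer-slot m k 2≤k k≤4 = cong₂ (λ u i → iter (rot u) i v) (proj₂ (rim-index m)) (proj₂ (outer-index k 2≤k k≤4))

  slots-cover : ∀ y → Dist≤2 G v y → ∃[ σ ] y ≡ slot σ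
  slots-cover y (_ , inj₁ vy) with U-onto y vy
  ... | j , _ , refl = rimσ j , rim-slot j
  slots-cover y (v≢y , inj₂ (z , vz , zy)) with U-onto z vz
  ... | i , _ , refl with rim-neighbour i y zy
  ... | inj₁ y≡v = ⊥-elim (v≢y (sym y≡v))
  ... | inj₂ (inj₁ e) = rimσ (4 + i) , trans e (rim-slot (4 + i))
  ... | inj₂ (inj₂ (inj₁ e)) = rimσ (suc i) , trans e (rim-slot (suc i))
  ... | inj₂ (inj₂ (inj₂ (k , 2≤k , k≤4 , e))) = outerσ i k 2≤k k≤4 , trans e (outer-slot i k 2≤k k≤4)

  slot-injective : ∀ σ τ → slot σ ≡ slot τ → σ ≡ τ
  slot-injective σ τ e = begin
      σ                             ≡⟨ index-slot-index σ ⟨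
      index-slot (slot-index σ)     ≡⟨ cong index-slot same-index ⟩
      index-slot (slot-index τ)     ≡⟨ index-slot-index τ ⟩
      τ                             ∎
    where
      open ≡-Reasoning
      slot₂₀ : Fin 20 → Fin n
      slot₂₀ s = slot (index-slot s)
      at-index : ∀ σ → slot₂₀ (slot-index σ) ≡ slot σ
      at-index σ = cong slot (index-slot-index σ)
      same-index : slot-index σ ≡ slot-index τ
      same-index = second-neighbourhood-injective G mc R plane v (wheel G R v deg5 triangles5) slot₂₀
        (λ y d → let (σ , y≡) = slots-cover y d in slot-index σ , trans y≡ (sym (at-index σ)))
        (slot-index σ) (slot-index τ) (trans (at-index σ) (trans e (sym (at-index τ))))

  outer≢rim : ∀ m k m' → 2 ≤ k → k ≤ 4 → ¬ E m k ≡ U m'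
  outer≢rim m k m' 2≤k k≤4 e with slot-injective (outerσ m k 2≤k k≤4) (rimσ m') (trans (sym (outer-slot m k 2≤k k≤4)) (trans e (rim-slot m')))
  ... | ()

  outer-determines-rim : ∀ m k m' k' → 2 ≤ k → k ≤ 4 → 2 ≤ k' → k' ≤ 4 → E m k ≡ E m' k' → U m ≡ U m'
  outer-determines-rim m k m' k' 2≤k k≤4 2≤k' k'≤4 e =
    trans (rim-slot m) (trans (cong (λ σ → U (toℕ (rim-of σ))) same-slot) (sym (rim-slot m')))
    where
      same-slot : outerσ m k 2≤k k≤4 ≡ outerσ m' k' 2≤k' k'≤4
      same-slot = slot-injective _ _ (trans (sym (outer-slot m k 2≤k k≤4)) (trans e (outer-slot m' k' 2≤k' k'≤4)))

  -- The last neighbour E i (p i ∸ 1) = U (suc i) must differ from v, from E i 1 = U (4 + i)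
  -- and from the outer slots E i 2, E i 3, E i 4.
  rim-deg≡6 : ∀ i → deg G (U i) ≡ 6
  rim-deg≡6 i = trans (deg≡p i) (six (p i) refl)
    where
      last : ∀ q → p i ≡ q → E i (q ∸ 1) ≡ U (suc i)
      last q e = trans (cong (λ r → E i (r ∸ 1)) (sym e)) (E-last i)
      2≤2 : 2 ≤ 2
      2≤2 = s≤s (s≤s z≤n)
      six : ∀ q → p i ≡ q → p i ≡ 6
      six 0 e = ⊥-elim (<-irrefl refl (subst (1 ≤_) e (Period.1≤p (rot-period (U i) v (U-v i)))))
      six 1 e = ⊥-elim (U≢v (suc i) (sym (last 1 e)))
      six 2 e = ⊥-elim (4≢1 (U-shift-injective i 4 1 ≤-refl (s≤s (s≤s z≤n)) (trans (sym (E-1 i)) (last 2 e))))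
        where
          4≢1 : ¬ 4 ≡ 1
          4≢1 ()
      six 3 e = ⊥-elim (outer≢rim i 2 (suc i) 2≤2 (s≤s (s≤s z≤n)) (last 3 e))
      six 4 e = ⊥-elim (outer≢rim i 3 (suc i) (s≤s (s≤s z≤n)) (s≤s (s≤s (s≤s z≤n))) (last 4 e))
      six 5 e = ⊥-elim (outer≢rim i 4 (suc i) (s≤s (s≤s z≤n)) ≤-refl (last 5 e))
      six 6 e = e
      six (suc (suc (suc (suc (suc (suc (suc q))))))) e =
        ⊥-elim (<⇒≱ (s≤s (s≤s (s≤s (s≤s (s≤s (s≤s (s≤s z≤n))))))) (subst (_≤ 6) e (p≤6 i)))

  p≡6 : ∀ i → p i ≡ 6
  p≡6 i = trans (sym (deg≡p i)) (rim-deg≡6 i)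

  outer-adj-rim⇒same : ∀ i k m → 2 ≤ k → k ≤ 4 → adj (U m) (E i k) ≡ true → U m ≡ U i
  outer-adj-rim⇒same i k m 2≤k k≤4 mE with rim-neighbour m (E i k) mE
  ... | inj₁ Eᵢₖ≡v = ⊥-elim (Period.minimal (rot-period (U i) v (U-v i)) k (≤-trans (s≤s z≤n) 2≤k)
                                            (subst (k <_) (sym (p≡6 i)) (s≤s (≤-trans k≤4 (n≤1+n 4)))) Eᵢₖ≡v)
  ... | inj₂ (inj₁ e) = ⊥-elim (outer≢rim i k (4 + m) 2≤k k≤4 e)
  ... | inj₂ (inj₂ (inj₁ e)) = ⊥-elim (outer≢rim i k (suc m) 2≤k k≤4 e)
  ... | inj₂ (inj₂ (inj₂ (k' , 2≤k' , k'≤4 , e))) = sym (outer-determines-rim i k m k' 2≤k k≤4 2≤k' k'≤4 e)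

  no-triangle-at-E₂ : ∀ i → ¬ faceDeg (U i , E i 2) ≡ 3
  no-triangle-at-E₂ i f3 = 4≢0 (U-shift-injective i 4 0 ≤-refl (s≤s z≤n) (outer-adj-rim⇒same i 2 (4 + i) ≤-refl (s≤s (s≤s z≤n))
                             (subst (λ u → adj u (E i 2) ≡ true) (E-1 i) (triangle-adj (U i) (E i 1) (E-adj i 1) f3))))
    where
      4≢0 : ¬ 4 ≡ 0
      4≢0 ()

  no-triangle-at-E₅ : ∀ i → ¬ faceDeg (U i , E i 5) ≡ 3
  no-triangle-at-E₅ i f3 = 1≢0 (U-shift-injective i 1 0 (s≤s (s≤s z≤n)) (s≤s z≤n) (outer-adj-rim⇒same i 4 (suc i) (s≤s (s≤s z≤n)) ≤-refl
                             (adj-sym (subst (λ u → adj (E i 4) u ≡ true) E₅≡Uᵢ₊₁ (triangle-adj (U i) (E i 4) (E-adj i 4) f3)))))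
    where
      1≢0 : ¬ 1 ≡ 0
      1≢0 ()
      E₅≡Uᵢ₊₁ : E i 5 ≡ U (suc i)
      E₅≡Uᵢ₊₁ = trans (cong (λ q → E i (q ∸ 1)) (sym (p≡6 i))) (E-last i)

  rim-triangles≤4 : ∀ i → facesOfDegAt 3 (U i) ≤ 4
  rim-triangles≤4 i = ≤-trans (facesOfDegAt≤ 3 (U i)) (#Fin.covered⇒card≤ 4 others _ covered)
    where
      others : Fin 4 → Fin n
      others fz = E i 0
      others (fs fz) = E i 1
      others (fs (fs fz)) = E i 3
      others (fs (fs (fs fz))) = E i 4
      covered : ∀ x → (adj (U i) x ∧ (faceDeg (U i , x) ≡ᵇ 3)) ≡ true → ∃[ j ] x ≡ others j
      covered x t with ∧-elim {adj (U i) x} t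
      ... | ix , tri with E-onto i x ix
      ... | 0 , _ , e = fz , e
      ... | 1 , _ , e = fs fz , e
      ... | 2 , _ , refl = ⊥-elim (no-triangle-at-E₂ i (≡ᵇ⇒≡ _ _ (≡true⇒T tri)))
      ... | 3 , _ , e = fs (fs fz) , e
      ... | 4 , _ , e = fs (fs (fs fz)) , e
      ... | 5 , _ , refl = ⊥-elim (no-triangle-at-E₅ i (≡ᵇ⇒≡ _ _ (≡true⇒T tri)))
      ... | suc (suc (suc (suc (suc (suc k))))) , k<p , _ = ⊥-elim (beyond-6 i _ (s≤s (s≤s (s≤s (s≤s (s≤s (s≤s z≤n)))))) k<p)

  neighbours-deg6 : nbrsOfDeg G 6 v ≡ 5
  neighbours-deg6 = trans (count-cong _ (adj v) deg6) deg5
    where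
      deg6 : ∀ w → (adj v w ∧ (deg G w ≡ᵇ 6)) ≡ adj v w
      deg6 w with adj v w in vw
      ... | false = refl
      ... | true with U-onto w vw
      ... | j , _ , refl rewrite rim-deg≡6 j = refl

lemma5 : (G : Graph) → MinimalCounterexample G →
         (R : Rotation G) → Faces.IsPlane G R →
         (v : Fin (Graph.n G)) → deg G v ≡ 5 →
         Faces.facesOfDegAt G R 3 v ≡ 5 →
         nbrsOfDeg G 6 v ≡ 5 ×
         (∀ w → Graph.adj G v w ≡ true → deg G w ≡ 6 → Faces.facesOfDegAt G R 3 w ≤ 4)
lemma5 G mc R plane v deg5 triangles5 = neighbours-deg6 G mc R plane v deg5 triangles5 , rim-bound
  where
    open Wheel (wheel G R v deg5 triangles5)
    -- every neighbour of v has degree 6 (rim-deg≡6)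
    rim-bound : ∀ w → Graph.adj G v w ≡ true → deg G w ≡ 6 → Faces.facesOfDegAt G R 3 w ≤ 4
    rim-bound w vw _ with U-onto w vw
    ... | j , _ , refl = rim-triangles≤4 G mc R plane v deg5 triangles5 j
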